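{- Let $$G(t,s,z)=\sum_T t^{\mathrm{old}(T)}\, s^{\mathrm{young}(T)}\, z^{e(T)},$$ where the sum runs over all plane trees $T$ (including the tree with a single vertex and no edges), $\mathrm{old}(T)$ and $\mathrm{young}(T)$ denote the numbers of old leaves and young leaves of $T$, and $e(T)$ is the number of edges of $T$. Then, as formal power series, $$G(t,s,z)=\frac{1+z-sz-\sqrt{1-2(1+s)z+(1-4t+2s+s^2)z^2}}{2z}.$$
   Context: A plane (ordered) tree is a rooted tree in which the children of each vertex are linearly ordered (from left to right). A leaf is a vertex with no children; by convention, the tree consisting of a single vertex (no edges) has no leaves. A leaf is called an old leaf if it is the leftmost child of its parent, and a young leaf otherwise. -}

module Defs where

open import Data.Nat as ℕ using (ℕ; zero; suc; _∸_; _≡ᵇ_)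
open import Data.Integer as ℤ using (ℤ; +_)
open import Data.Rational using (ℚ; 0ℚ; 1ℚ; ½; _/_; _+_; _*_; _-_; -_)
open import Data.Bool using (if_then_else_; _∧_)
open import Data.List using (List; []; _∷_)
open import Data.Product using (Σ; _×_)
open import Relation.Binary.PropositionalEquality using (_≡_)

data PTree : Set where
  node : List PTree → PTree

isLeaf : PTree → ℕ
isLeaf (node [])      = 1
isLeaf (node (_ ∷ _)) = 0

mutual
  edges : PTree → ℕ
  edges (node cs) = edgesL cs

  edgesL : List PTree → ℕ
  edgesL []       = 0
  edgesL (c ∷ cs) = suc (edges c ℕ.+ edgesL cs)

mutual
  -- number of old leaves: leaves that are the leftmost child of their parent
  old : PTree → ℕ
  old (node [])       = 0
  old (node (c ∷ cs)) = isLeaf c ℕ.+ old c ℕ.+ oldL cs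

  oldL : List PTree → ℕ
  oldL []       = 0
  oldL (c ∷ cs) = old c ℕ.+ oldL cs

mutual
  -- number of young leaves: leaves that are not the leftmost child
  young : PTree → ℕ
  young (node [])       = 0
  young (node (c ∷ cs)) = young c ℕ.+ youngL cs

  youngL : List PTree → ℕ
  youngL []       = 0
  youngL (c ∷ cs) = isLeaf c ℕ.+ young c ℕ.+ youngL cs

TreesWith : ℕ → ℕ → ℕ → Set
TreesWith i j n = Σ PTree (λ T → (old T ≡ i) × ((young T ≡ j) × (edges T ≡ n)))

-- Formal power series in t, s, z over ℚ:
-- F i j n = coefficient of t^i s^j z^n.

Series : Set
Series = ℕ → ℕ → ℕ → ℚ

sumTo : ℕ → (ℕ → ℚ) → ℚ
sumTo zero    f = f 0
sumTo (suc m) f = sumTo m f + f (suc m)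

infixl 6 _⊕_ _⊖_
infixl 7 _⊛_

_⊕_ : Series → Series → Series
(f ⊕ g) i j n = f i j n + g i j n

_⊖_ : Series → Series → Series
(f ⊖ g) i j n = f i j n - g i j n

scale : ℚ → Series → Series
scale q f i j n = q * f i j n

_⊛_ : Series → Series → Series
(f ⊛ g) i j n =
  sumTo i λ a → sumTo j λ b → sumTo n λ c →
    f a b c * g (i ∸ a) (j ∸ b) (n ∸ c)

mono : ℕ → ℕ → ℕ → Series
mono a b c i j n = if (i ≡ᵇ a) ∧ ((j ≡ᵇ b) ∧ (n ≡ᵇ c)) then 1ℚ else 0ℚ

one : Series
one = mono 0 0 0

pow : Series → ℕ → Series
pow f zero    = one
pow f (suc k) = f ⊛ pow f k

binHalf : ℕ → ℚ
binHalf zero    = 1ℚ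
binHalf (suc k) = binHalf k * ((½ - (+ k / 1)) * (+ 1 / suc k))

-- Square root of a series D with constant term 1 (in z), via the
-- binomial series  sqrt(1+u) = Σ_k binom(1/2,k) u^k  with u = D - 1.
-- Since u has no z^0 term, only k ≤ n contribute to the z^n coefficient.
sqrt1 : Series → Series
sqrt1 D i j n = sumTo n λ k → binHalf k * pow (D ⊖ one) k i j n

Disc : Series
Disc = one
     ⊖ scale (+ 2 / 1) (mono 0 0 1 ⊕ mono 0 1 1)
     ⊕ (mono 0 0 2 ⊖ scale (+ 4 / 1) (mono 1 0 2)
        ⊕ scale (+ 2 / 1) (mono 0 1 2) ⊕ mono 0 2 2)

Numer : Series
Numer = ((one ⊕ mono 0 0 1) ⊖ mono 0 1 1) ⊖ sqrt1 Disc

-- right-hand side  Numer / (2 z): divide by z = shift the z-index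
RHS : Series
RHS i j n = ½ * Numer i j (suc n)

module Submission where

-- A plane tree is a single vertex or a root with a leftmost subtree followed by a forest. A leaf
-- child is old when leftmost and young otherwise, so with Y the generating function of forests in
-- which leaf roots count as young,
--   G = 1 + z (t + G − 1) Y   and   Y = 1 + z (s + G − 1) Y.
-- Eliminating Y shows that 1 + z − sz − 2zG squares to the discriminant D. The binomial series
-- Σ binom(1/2,k) (D − 1)^k squares to D as well, and both roots have constant term 1; over ℚ a
-- power series whose constant term is 2 is not a zero divisor, so the two roots coincide and
-- 2zG = 1 + z − sz − √D. Coefficients of G count trees through a duplicate-free enumeration.

open import Algebra.Bundles using (CommutativeRing; Semiring)
open import Algebra.Bundles.Raw using (RawRing)
open import Algebra.Solver.Ring.AlmostCommutativeRing using (_-Raw-AlmostCommutative⟶_; fromCommutativeRing)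
import Data.Rational.Properties as ℚ

module FiniteSum {c ℓ} (R : CommutativeRing c ℓ) where

  open import Data.Nat as ℕ using (ℕ; zero; suc; _∸_; _≤_; _<_; z≤n; s≤s)
  open import Data.Nat.Properties
    using (≤-refl; m≤n⇒m≤1+n; n∸n≡0; +-∸-assoc; m≤n+m; ≤-pred; ≤∧≢⇒<; <⇒≢)
  open import Relation.Binary.PropositionalEquality as ≡ using (_≡_)
  open import Relation.Nullary using (¬_; yes; no)

  open CommutativeRing R
  open import Relation.Binary.Reasoning.Setoid setoid
  open import Algebra.Properties.CommutativeSemigroup +-commutativeSemigroup using (interchange)
  open import Algebra.Properties.Ring ring using (-‿+-comm)

  sumTo : ℕ → (ℕ → Carrier) → Carrier
  sumTo zero    f = f 0
  sumTo (suc n) f = sumTo n f + f (suc n)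

  sum-cong-≤ : ∀ n {f g} → (∀ a → a ≤ n → f a ≈ g a) → sumTo n f ≈ sumTo n g
  sum-cong-≤ zero    f≈g = f≈g 0 z≤n
  sum-cong-≤ (suc n) f≈g =
    +-cong (sum-cong-≤ n λ a a≤n → f≈g a (m≤n⇒m≤1+n a≤n)) (f≈g (suc n) ≤-refl)

  sum-cong : ∀ n {f g} → (∀ a → f a ≈ g a) → sumTo n f ≈ sumTo n g
  sum-cong n f≈g = sum-cong-≤ n λ a _ → f≈g a

  sum-zero : ∀ n {f} → (∀ a → a ≤ n → f a ≈ 0#) → sumTo n f ≈ 0#
  sum-zero zero    f≈0 = f≈0 0 z≤n
  sum-zero (suc n) f≈0 = begin
    sumTo n _ + _ ≈⟨ +-cong (sum-zero n λ a a≤n → f≈0 a (m≤n⇒m≤1+n a≤n)) (f≈0 (suc n) ≤-refl) ⟩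
    0# + 0#       ≈⟨ +-identityˡ 0# ⟩
    0#            ∎

  sum-+ : ∀ n f g → sumTo n (λ a → f a + g a) ≈ sumTo n f + sumTo n g
  sum-+ zero    f g = refl
  sum-+ (suc n) f g = trans (+-congʳ (sum-+ n f g)) (interchange _ _ _ _)

  *-distribˡ-sum : ∀ n x f → x * sumTo n f ≈ sumTo n (λ a → x * f a)
  *-distribˡ-sum zero    x f = refl
  *-distribˡ-sum (suc n) x f = trans (distribˡ x _ _) (+-congʳ (*-distribˡ-sum n x f))

  *-distribʳ-sum : ∀ n x f → sumTo n f * x ≈ sumTo n (λ a → f a * x)
  *-distribʳ-sum zero    x f = refl
  *-distribʳ-sum (suc n) x f = trans (distribʳ x _ _) (+-congʳ (*-distribʳ-sum n x f))

  -‿sum : ∀ n f → - sumTo n f ≈ sumTo n (λ a → - f a)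
  -‿sum zero    f = refl
  -‿sum (suc n) f = trans (sym (-‿+-comm _ _)) (+-congʳ (-‿sum n f))

  sum-unfoldˡ : ∀ n f → sumTo (suc n) f ≈ f 0 + sumTo n (λ a → f (suc a))
  sum-unfoldˡ zero    f = refl
  sum-unfoldˡ (suc n) f = trans (+-congʳ (sum-unfoldˡ n f)) (+-assoc _ _ _)

  sum-comm : ∀ m n (h : ℕ → ℕ → Carrier) → sumTo m (λ a → sumTo n (h a)) ≈ sumTo n (λ b → sumTo m (λ a → h a b))
  sum-comm zero    n h = refl
  sum-comm (suc m) n h = trans (+-congʳ (sum-comm m n h)) (sym (sum-+ n _ _))

  private
    suc∸ : ∀ {n a} → a ≤ n → suc n ∸ a ≡ suc (n ∸ a)
    suc∸ = +-∸-assoc 1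

  sum-reverse : ∀ n f → sumTo n (λ a → f (n ∸ a)) ≈ sumTo n f
  sum-reverse zero    f = refl
  sum-reverse (suc n) f = begin
    sumTo n (λ a → f (suc n ∸ a)) + f (suc n ∸ suc n)
      ≈⟨ +-cong (sum-cong-≤ n λ a a≤n → reflexive (≡.cong f (suc∸ a≤n)))
                (reflexive (≡.cong f (n∸n≡0 n))) ⟩
    sumTo n (λ a → f (suc (n ∸ a))) + f 0
      ≈⟨ +-congʳ (sum-reverse n (λ b → f (suc b))) ⟩
    sumTo n (λ b → f (suc b)) + f 0
      ≈⟨ +-comm _ _ ⟩
    f 0 + sumTo n (λ b → f (suc b))
      ≈⟨ sym (sum-unfoldˡ n f) ⟩
    sumTo (suc n) f ∎

  sum-triangle : ∀ n (h : ℕ → ℕ → Carrier) →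
    sumTo n (λ k → sumTo k (λ a → h a (k ∸ a))) ≈ sumTo n (λ a → sumTo (n ∸ a) (h a))
  sum-triangle zero    h = refl
  sum-triangle (suc n) h = begin
    sumTo n (λ k → sumTo k (λ a → h a (k ∸ a))) + sumTo (suc n) (λ a → h a (suc n ∸ a))
      ≈⟨ +-cong (sum-triangle n h)
                (+-cong (sum-cong-≤ n λ a a≤n → reflexive (≡.cong (h a) (suc∸ a≤n)))
                        (reflexive (≡.cong (h (suc n)) (n∸n≡0 n)))) ⟩
    sumTo n (λ a → sumTo (n ∸ a) (h a)) + (sumTo n (λ a → h a (suc (n ∸ a))) + h (suc n) 0)
      ≈⟨ sym (+-assoc _ _ _) ⟩
    (sumTo n (λ a → sumTo (n ∸ a) (h a)) + sumTo n (λ a → h a (suc (n ∸ a)))) + h (suc n) 0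
      ≈⟨ +-congʳ (sym (sum-+ n _ _)) ⟩
    sumTo n (λ a → sumTo (suc (n ∸ a)) (h a)) + h (suc n) 0
      ≈⟨ +-cong (sum-cong-≤ n λ a a≤n → reflexive (≡.cong (λ m → sumTo m (h a)) (≡.sym (suc∸ a≤n))))
                (reflexive (≡.cong (λ m → sumTo m (h (suc n))) (≡.sym (n∸n≡0 n)))) ⟩
    sumTo (suc n) (λ a → sumTo (suc n ∸ a) (h a)) ∎

  sum-extend : ∀ m d f → (∀ a → m < a → f a ≈ 0#) → sumTo (d ℕ.+ m) f ≈ sumTo m f
  sum-extend m zero    f f≈0 = refl
  sum-extend m (suc d) f f≈0 =
    trans (+-cong (sum-extend m d f f≈0) (f≈0 _ (s≤s (m≤n+m m d)))) (+-identityʳ _)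

  sum-single : ∀ n k f → k ≤ n → (∀ a → a ≤ n → ¬ a ≡ k → f a ≈ 0#) → sumTo n f ≈ f k
  sum-single zero    .0 f z≤n _   = refl
  sum-single (suc n) k  f k≤  f≈0 with k ℕ.≟ suc n
  ... | yes ≡.refl =
    trans (+-congʳ (sum-zero n λ a a≤n → f≈0 a (m≤n⇒m≤1+n a≤n) (<⇒≢ (s≤s a≤n))))
          (+-identityˡ _)
  ... | no k≢ =
    trans (+-cong (sum-single n k f (≤-pred (≤∧≢⇒< k≤ k≢)) λ a a≤n → f≈0 a (m≤n⇒m≤1+n a≤n))
                  (f≈0 (suc n) ≤-refl λ e → k≢ (≡.sym e)))
          (+-identityʳ _)

module PowerSeries {c ℓ} (R : CommutativeRing c ℓ) where

  open import Data.Bool using (true; false; if_then_else_; T)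
  open import Data.Empty using (⊥-elim)
  open import Data.Unit using (tt)
  open import Data.Nat as ℕ using (ℕ; zero; suc; _∸_; _≤_; _<_; z≤n; s≤s; z<s; _≡ᵇ_)
  open import Data.Nat.Properties
    using (≡ᵇ⇒≡; ≡⇒≡ᵇ; _≤?_; ≰⇒>; ≤-refl; ≤-antisym; <⇒≢; ≤-<-trans; <-≤-trans; m≤m+n; +-monoʳ-<;
           ∸-monoʳ-<; m∸n≤m; m∸[m∸n]≡n; m+[n∸m]≡n; ∸-+-assoc; m+n∸m≡n; m∸n+n≡m; n∸n≡0)
  open import Data.Product using (_,_)
  open import Relation.Binary.PropositionalEquality as ≡ using (_≡_)
  open import Relation.Binary.Structures using (IsEquivalence)
  open import Relation.Nullary using (¬_; Dec; yes; no)

  open CommutativeRing R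
  open import Relation.Binary.Reasoning.Setoid setoid
  open import Algebra.Properties.Ring ring using (-0#≈0#)
  open import Algebra.Properties.CommutativeSemigroup *-commutativeSemigroup using () renaming (interchange to *-interchange)
  open FiniteSum R

  Series : Set c
  Series = ℕ → Carrier

  infix  4 _≋_
  infixl 6 _+ₛ_
  infixl 7 _*ₛ_

  _≋_ : Series → Series → Set ℓ
  f ≋ g = ∀ n → f n ≈ g n

  _+ₛ_ : Series → Series → Series
  (f +ₛ g) n = f n + g n

  -ₛ_ : Series → Series
  (-ₛ f) n = - f n

  _*ₛ_ : Series → Series → Series
  (f *ₛ g) n = sumTo n (λ a → f a * g (n ∸ a))

  0ₛ : Series
  0ₛ _ = 0#

  monomial : ℕ → Carrier → Series
  monomial k x n = if n ≡ᵇ k then x else 0#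

  const : Carrier → Series
  const = monomial 0

  X : Series
  X = monomial 1 1#

  monomial-at : ∀ k x → monomial k x k ≡ x
  monomial-at k x with k ≡ᵇ k | ≡⇒≡ᵇ k k ≡.refl
  ... | true | _ = ≡.refl

  monomial-≢ : ∀ {k n} x → ¬ n ≡ k → monomial k x n ≡ 0#
  monomial-≢ {k} {n} x n≢k with n ≡ᵇ k in eq
  ... | true  = ⊥-elim (n≢k (≡ᵇ⇒≡ n k (≡.subst T (≡.sym eq) tt)))
  ... | false = ≡.refl

  monomial-cong : ∀ k {x y} → x ≈ y → monomial k x ≋ monomial k y
  monomial-cong k x≈y n with n ≡ᵇ k
  ... | true  = x≈y
  ... | false = refl

  monomial-*ˡ : ∀ k x f {n} → k ≤ n → (monomial k x *ₛ f) n ≈ x * f (n ∸ k)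
  monomial-*ˡ k x f {n} k≤n = begin
    sumTo n (λ a → monomial k x a * f (n ∸ a))
      ≈⟨ sum-single n k _ k≤n (λ a _ a≢k → trans (*-congʳ (reflexive (monomial-≢ x a≢k))) (zeroˡ _)) ⟩
    monomial k x k * f (n ∸ k)
      ≈⟨ *-congʳ (reflexive (monomial-at k x)) ⟩
    x * f (n ∸ k) ∎

  monomial-*ˡ-< : ∀ k x f {n} → n < k → (monomial k x *ₛ f) n ≈ 0#
  monomial-*ˡ-< k x f n<k = sum-zero _ λ a a≤n →
    trans (*-congʳ (reflexive (monomial-≢ x (<⇒≢ (≤-<-trans a≤n n<k))))) (zeroˡ _)

  const-*ˡ : ∀ x f n → (const x *ₛ f) n ≈ x * f n
  const-*ˡ x f n = monomial-*ˡ 0 x f z≤n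

  *ₛ-cong : ∀ {f f′ g g′} → f ≋ f′ → g ≋ g′ → f *ₛ g ≋ f′ *ₛ g′
  *ₛ-cong f≋f′ g≋g′ n = sum-cong n λ a → *-cong (f≋f′ a) (g≋g′ (n ∸ a))

  *ₛ-comm : ∀ f g → f *ₛ g ≋ g *ₛ f
  *ₛ-comm f g n = begin
    sumTo n (λ a → f a * g (n ∸ a))
      ≈⟨ sym (sum-reverse n _) ⟩
    sumTo n (λ a → f (n ∸ a) * g (n ∸ (n ∸ a)))
      ≈⟨ sum-cong-≤ n (λ a a≤n → trans (*-comm _ _) (*-congʳ (reflexive (≡.cong g (m∸[m∸n]≡n a≤n))))) ⟩
    sumTo n (λ a → g a * f (n ∸ a)) ∎

  *ₛ-assoc : ∀ f g h → (f *ₛ g) *ₛ h ≋ f *ₛ (g *ₛ h)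
  *ₛ-assoc f g h n = begin
    sumTo n (λ k → sumTo k (λ a → f a * g (k ∸ a)) * h (n ∸ k))
      ≈⟨ sum-cong n (λ k → *-distribʳ-sum k _ _) ⟩
    sumTo n (λ k → sumTo k (λ a → f a * g (k ∸ a) * h (n ∸ k)))
      ≈⟨ sum-cong n (λ k → sum-cong-≤ k λ a a≤k →
           trans (*-assoc _ _ _) (*-congˡ (*-congˡ (reflexive (≡.cong h (n∸k≡n∸a∸[k∸a] a≤k)))))) ⟩
    sumTo n (λ k → sumTo k (λ a → H a (k ∸ a)))
      ≈⟨ sum-triangle n H ⟩
    sumTo n (λ a → sumTo (n ∸ a) (H a))
      ≈⟨ sum-cong n (λ a → sym (*-distribˡ-sum (n ∸ a) _ _)) ⟩
    sumTo n (λ a → f a * sumTo (n ∸ a) (λ b → g b * h (n ∸ a ∸ b))) ∎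
    where
    H : ℕ → ℕ → Carrier
    H a b = f a * (g b * h (n ∸ a ∸ b))
    n∸k≡n∸a∸[k∸a] : ∀ {k a} → a ≤ k → n ∸ k ≡ n ∸ a ∸ (k ∸ a)
    n∸k≡n∸a∸[k∸a] {k} {a} a≤k =
      ≡.trans (≡.cong (n ∸_) (≡.sym (m+[n∸m]≡n a≤k))) (≡.sym (∸-+-assoc n a (k ∸ a)))

  *ₛ-identityˡ : ∀ f → const 1# *ₛ f ≋ f
  *ₛ-identityˡ f n = trans (const-*ˡ 1# f n) (*-identityˡ _)

  *ₛ-distribˡ : ∀ f g h → f *ₛ (g +ₛ h) ≋ f *ₛ g +ₛ f *ₛ h
  *ₛ-distribˡ f g h n = trans (sum-cong n λ a → distribˡ _ _ _) (sum-+ n _ _)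

  powerSeriesRing : CommutativeRing c ℓ
  powerSeriesRing = record
    { Carrier = Series ; _≈_ = _≋_ ; _+_ = _+ₛ_ ; _*_ = _*ₛ_ ; -_ = -ₛ_
    ; 0# = 0ₛ ; 1# = const 1#
    ; isCommutativeRing = record
      { isRing = record
        { +-isAbelianGroup = record
          { isGroup = record
            { isMonoid = record
              { isSemigroup = record
                { isMagma = record
                  { isEquivalence = ≋-isEquivalence
                  ; ∙-cong = λ f≋f′ g≋g′ n → +-cong (f≋f′ n) (g≋g′ n) }
                ; assoc = λ f g h n → +-assoc (f n) (g n) (h n) }
              ; identity = (λ f n → +-identityˡ (f n)) , (λ f n → +-identityʳ (f n)) }
            ; inverse = (λ f n → -‿inverseˡ (f n)) , (λ f n → -‿inverseʳ (f n))
            ; ⁻¹-cong = λ f≋g n → -‿cong (f≋g n) }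
          ; comm = λ f g n → +-comm (f n) (g n) }
        ; *-cong = *ₛ-cong
        ; *-assoc = *ₛ-assoc
        ; *-identity = *ₛ-identityˡ , λ f n → trans (*ₛ-comm f _ n) (*ₛ-identityˡ f n)
        ; distrib = *ₛ-distribˡ , λ f g h n →
            trans (*ₛ-comm (g +ₛ h) f n) (trans (*ₛ-distribˡ f g h n) (+-cong (*ₛ-comm f g n) (*ₛ-comm f h n)))
        }
      ; *-comm = *ₛ-comm
      }
    }
    where
    ≋-isEquivalence : IsEquivalence _≋_
    ≋-isEquivalence = record
      { refl = λ _ → refl ; sym = λ f≋g n → sym (f≋g n) ; trans = λ f≋g g≋h n → trans (f≋g n) (g≋h n) }

  open import Algebra.Definitions.RawSemiring (Semiring.rawSemiring (CommutativeRing.semiring powerSeriesRing)) public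
    using () renaming (_^_ to _^ₛ_)

  monomial-* : ∀ k m x y → monomial k x *ₛ monomial m y ≋ monomial (k ℕ.+ m) (x * y)
  monomial-* k m x y n with k ≤? n
  ... | no k≰n = trans (monomial-*ˡ-< k x (monomial m y) (≰⇒> k≰n))
                       (sym (reflexive (monomial-≢ _ λ n≡k+m → k≰n (≡.subst (k ≤_) (≡.sym n≡k+m) (m≤m+n k m)))))
  ... | yes k≤n = trans (monomial-*ˡ k x (monomial m y) k≤n) (compare (n ∸ k ℕ.≟ m))
    where
    compare : Dec (n ∸ k ≡ m) → x * monomial m y (n ∸ k) ≈ monomial (k ℕ.+ m) (x * y) n
    compare (yes ≡.refl) rewrite m+[n∸m]≡n k≤n | monomial-at (n ∸ k) y | monomial-at n (x * y) = refl
    compare (no n∸k≢m) = begin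
      x * monomial m y (n ∸ k)  ≈⟨ *-congˡ (reflexive (monomial-≢ y n∸k≢m)) ⟩
      x * 0#                    ≈⟨ zeroʳ x ⟩
      0#                        ≈⟨ reflexive (monomial-≢ _ λ n≡k+m → n∸k≢m (≡.trans (≡.cong (_∸ k) n≡k+m) (m+n∸m≡n k m))) ⟨
      monomial (k ℕ.+ m) (x * y) n ∎

  X*ₛ-suc : ∀ f n → (X *ₛ f) (suc n) ≈ f n
  X*ₛ-suc f n = trans (monomial-*ˡ 1 1# f (s≤s z≤n)) (*-identityˡ (f n))

  X*ₛ-zero : ∀ f → (X *ₛ f) 0 ≈ 0#
  X*ₛ-zero f = monomial-*ˡ-< 1 1# f (s≤s z≤n)

  module Σₛ = FiniteSum powerSeriesRing

  sumTo-apply : ∀ n (h : ℕ → Series) i → Σₛ.sumTo n h i ≡ sumTo n (λ a → h a i)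
  sumTo-apply zero    h i = ≡.refl
  sumTo-apply (suc n) h i = ≡.cong (_+ h (suc n) i) (sumTo-apply n h i)

  const-cong : ∀ {x y} → x ≈ y → const x ≋ const y
  const-cong = monomial-cong 0

  const-+ : ∀ x y → const (x + y) ≋ const x +ₛ const y
  const-+ x y zero    = refl
  const-+ x y (suc n) = sym (+-identityˡ 0#)

  const-* : ∀ x y → const (x * y) ≋ const x *ₛ const y
  const-* x y n = sym (monomial-* 0 0 x y n)

  const-0 : const 0# ≋ 0ₛ
  const-0 zero    = refl
  const-0 (suc n) = refl

  const-‿ : ∀ x → const (- x) ≋ -ₛ const x
  const-‿ x zero    = refl
  const-‿ x (suc n) = sym -0#≈0#

  infixr 9 _∘ₛ_

  _∘ₛ_ : Series → Series → Series
  (f ∘ₛ u) n = sumTo n (λ k → f k * (u ^ₛ k) n)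

  module Composition {u : Series} (u₀≈0 : u 0 ≈ 0#) where

    open import Algebra.Properties.Semiring.Exp (CommutativeRing.semiring powerSeriesRing) using (^-homo-*)

    ^-vanishes-below : ∀ k n → n < k → (u ^ₛ k) n ≈ 0#
    ^-vanishes-below (suc k) n (s≤s n≤k) = sum-zero n term≈0
      where
      term≈0 : ∀ a → a ≤ n → u a * (u ^ₛ k) (n ∸ a) ≈ 0#
      term≈0 zero    _     = trans (*-congʳ u₀≈0) (zeroˡ _)
      term≈0 (suc a) a<n = trans (*-congˡ (^-vanishes-below k (n ∸ suc a) (<-≤-trans (∸-monoʳ-< z<s a<n) n≤k))) (zeroʳ _)

    private
      _^_at_ : Series → ℕ → ℕ → Carrier
      v ^ k at n = (v ^ₛ k) n

      term≈0-beyond : ∀ x {k n} → n < k → x * u ^ k at n ≈ 0#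
      term≈0-beyond x {k} {n} n<k = trans (*-congˡ (^-vanishes-below k n n<k)) (zeroʳ x)

    compose-extend : ∀ f {p n} → p ≤ n → (f ∘ₛ u) p ≈ sumTo n (λ k → f k * u ^ k at p)
    compose-extend f {p} {n} p≤n = sym (begin
      sumTo n F            ≡⟨ ≡.cong (λ m → sumTo m F) (≡.sym (m∸n+n≡m p≤n)) ⟩
      sumTo (n ∸ p ℕ.+ p) F ≈⟨ sum-extend p (n ∸ p) F (λ k → term≈0-beyond (f k)) ⟩
      sumTo p F            ∎)
      where
      F : ℕ → Carrier
      F k = f k * u ^ k at p

    compose-*-expand : ∀ f g n → ((f ∘ₛ u) *ₛ (g ∘ₛ u)) n ≈
      sumTo n (λ a → sumTo n (λ b → (f a * g b) * u ^ (a ℕ.+ b) at n))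
    compose-*-expand f g n = begin
      sumTo n (λ p → (f ∘ₛ u) p * (g ∘ₛ u) (n ∸ p))
        ≈⟨ sum-cong-≤ n (λ p p≤n → *-cong (compose-extend f p≤n) (compose-extend g (m∸n≤m n p))) ⟩
      sumTo n (λ p → sumTo n (λ a → F a p) * sumTo n (λ b → G b (n ∸ p)))
        ≈⟨ sum-cong n (λ p → trans (*-distribʳ-sum n _ _) (sum-cong n λ a → *-distribˡ-sum n _ _)) ⟩
      sumTo n (λ p → sumTo n (λ a → sumTo n (λ b → F a p * G b (n ∸ p))))
        ≈⟨ sum-comm n n _ ⟩
      sumTo n (λ a → sumTo n (λ p → sumTo n (λ b → F a p * G b (n ∸ p))))
        ≈⟨ sum-cong n (λ a → sum-comm n n _) ⟩
      sumTo n (λ a → sumTo n (λ b → sumTo n (λ p → F a p * G b (n ∸ p))))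
        ≈⟨ sum-cong n (λ a → sum-cong n λ b →
             trans (sum-cong n λ p → *-interchange _ _ _ _) (sym (*-distribˡ-sum n _ _))) ⟩
      sumTo n (λ a → sumTo n (λ b → (f a * g b) * ((u ^ₛ a) *ₛ (u ^ₛ b)) n))
        ≈⟨ sum-cong n (λ a → sum-cong n λ b → *-congˡ (sym (^-homo-* u a b n))) ⟩
      sumTo n (λ a → sumTo n (λ b → (f a * g b) * u ^ (a ℕ.+ b) at n)) ∎
      where
      F G : ℕ → ℕ → Carrier
      F a p = f a * u ^ a at p
      G b p = g b * u ^ b at p

    compose-expand : ∀ f g n → ((f *ₛ g) ∘ₛ u) n ≈
      sumTo n (λ a → sumTo n (λ b → (f a * g b) * u ^ (a ℕ.+ b) at n))
    compose-expand f g n = begin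
      sumTo n (λ k → sumTo k (λ a → f a * g (k ∸ a)) * u ^ k at n)
        ≈⟨ sum-cong n (λ k → *-distribʳ-sum k _ _) ⟩
      sumTo n (λ k → sumTo k (λ a → (f a * g (k ∸ a)) * u ^ k at n))
        ≈⟨ sum-cong n (λ k → sum-cong-≤ k λ a a≤k →
             *-congˡ (reflexive (≡.cong (λ m → u ^ m at n) (≡.sym (m+[n∸m]≡n a≤k))))) ⟩
      sumTo n (λ k → sumTo k (λ a → H a (k ∸ a)))
        ≈⟨ sum-triangle n H ⟩
      sumTo n (λ a → sumTo (n ∸ a) (H a))
        ≈⟨ sum-cong-≤ n (λ a a≤n → sym (extend a≤n)) ⟩
      sumTo n (λ a → sumTo n (H a)) ∎
      where
      H : ℕ → ℕ → Carrier
      H a b = (f a * g b) * u ^ (a ℕ.+ b) at n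
      extend : ∀ {a} → a ≤ n → sumTo n (H a) ≈ sumTo (n ∸ a) (H a)
      extend {a} a≤n = trans (reflexive (≡.cong (λ m → sumTo m (H a)) (≡.sym (m+[n∸m]≡n a≤n))))
        (sum-extend (n ∸ a) a (H a) λ b n∸a<b →
          term≈0-beyond (f a * g b) (≡.subst (_< a ℕ.+ b) (m+[n∸m]≡n a≤n) (+-monoʳ-< a n∸a<b)))

    compose-* : ∀ f g → (f *ₛ g) ∘ₛ u ≋ (f ∘ₛ u) *ₛ (g ∘ₛ u)
    compose-* f g n = trans (compose-expand f g n) (sym (compose-*-expand f g n))

    compose-cong : ∀ {f g} → f ≋ g → f ∘ₛ u ≋ g ∘ₛ u
    compose-cong f≋g n = sum-cong n λ k → *-congʳ (f≋g k)

    compose-+ : ∀ f g → (f +ₛ g) ∘ₛ u ≋ f ∘ₛ u +ₛ g ∘ₛ u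
    compose-+ f g n = trans (sum-cong n λ k → distribʳ _ _ _) (sum-+ n _ _)

    compose-monomial : ∀ k x → monomial k x ∘ₛ u ≋ λ n → x * u ^ k at n
    compose-monomial k x n with k ≤? n
    ... | yes k≤n = trans (sum-single n k _ k≤n λ a _ a≢k → trans (*-congʳ (reflexive (monomial-≢ x a≢k))) (zeroˡ _))
                          (*-congʳ (reflexive (monomial-at k x)))
    ... | no k≰n = trans (sum-zero n λ a a≤n → trans (*-congʳ (reflexive (monomial-≢ x (<⇒≢ (≤-<-trans a≤n n<k))))) (zeroˡ _))
                         (sym (term≈0-beyond x n<k))
      where n<k = ≰⇒> k≰n

    compose-1+X : (const 1# +ₛ X) ∘ₛ u ≋ const 1# +ₛ u
    compose-1+X n = begin
      ((const 1# +ₛ X) ∘ₛ u) n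
        ≈⟨ compose-+ (const 1#) X n ⟩
      (const 1# ∘ₛ u) n + (X ∘ₛ u) n
        ≈⟨ +-cong (compose-monomial 0 1# n) (compose-monomial 1 1# n) ⟩
      1# * const 1# n + 1# * (u *ₛ const 1#) n
        ≈⟨ +-cong (*-identityˡ _) (trans (*-identityˡ _) (trans (*ₛ-comm u _ n) (*ₛ-identityˡ u n))) ⟩
      const 1# n + u n ∎

    compose-square : ∀ f → f *ₛ f ≋ const 1# +ₛ X → (f ∘ₛ u) *ₛ (f ∘ₛ u) ≋ const 1# +ₛ u
    compose-square f f²≋1+X n = begin
      ((f ∘ₛ u) *ₛ (f ∘ₛ u)) n               ≈⟨ compose-* f f n ⟨
      ((f *ₛ f) ∘ₛ u) n                      ≈⟨ compose-cong f²≋1+X n ⟩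
      ((const 1# +ₛ X) ∘ₛ u) n               ≈⟨ compose-1+X n ⟩
      const 1# n + u n                       ∎

  module _ {e w : Series} (w₀-regular : ∀ x → x * w 0 ≈ 0# → x ≈ 0#) (ew≋0 : e *ₛ w ≋ 0ₛ) where

    private
      vanishes-upTo : ∀ n m → m ≤ n → e m ≈ 0#
      vanishes-upTo zero    .0 z≤n = w₀-regular (e 0) (ew≋0 0)
      vanishes-upTo (suc n) m m≤1+n with m ≤? n
      ... | yes m≤n = vanishes-upTo n m m≤n
      ... | no m≰n rewrite ≤-antisym m≤1+n (≰⇒> m≰n) = w₀-regular (e (suc n)) (begin
        e (suc n) * w 0                                           ≈⟨ +-identityˡ _ ⟨
        0# + e (suc n) * w 0                                      ≈⟨ +-cong lower≈0 (*-congˡ (reflexive (≡.cong w (n∸n≡0 n)))) ⟨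
        sumTo n (λ a → e a * w (suc n ∸ a)) + e (suc n) * w (suc n ∸ suc n) ≈⟨ ew≋0 (suc n) ⟩
        0#                                                        ∎)
        where
        lower≈0 : sumTo n (λ a → e a * w (suc n ∸ a)) ≈ 0#
        lower≈0 = sum-zero n λ a a≤n → trans (*-congʳ (vanishes-upTo n a a≤n)) (zeroˡ _)

    *ₛ-cancel-regularʳ : e ≋ 0ₛ
    *ₛ-cancel-regularʳ n = vanishes-upTo n n ≤-refl

  module _ {r₁ r₄} {C : RawRing r₁ r₄} (φ : C -Raw-AlmostCommutative⟶ fromCommutativeRing R) where
    open _-Raw-AlmostCommutative⟶_ φ

    const-homomorphism : C -Raw-AlmostCommutative⟶ fromCommutativeRing powerSeriesRing
    const-homomorphism = record
      { ⟦_⟧    = λ q → const ⟦ q ⟧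
      ; +-homo = λ p q n → trans (const-cong (+-homo p q) n) (const-+ _ _ n)
      ; *-homo = λ p q n → trans (const-cong (*-homo p q) n) (const-* _ _ n)
      ; -‿homo = λ p n → trans (const-cong (-‿homo p) n) (const-‿ _ n)
      ; 0-homo = λ n → trans (const-cong 0-homo n) (const-0 n)
      ; 1-homo = const-cong 1-homo
      }

module QuadraticRelation {c ℓ} (R : CommutativeRing c ℓ)
  (φ : CommutativeRing.rawRing ℚ.+-*-commutativeRing -Raw-AlmostCommutative⟶ fromCommutativeRing R) where

  open import Data.Integer using (+_)
  open import Data.Maybe using (just; nothing)
  open import Data.Rational using (_/_; 1ℚ)
  open import Relation.Binary.Definitions using (WeaklyDecidable)
  open import Relation.Binary.PropositionalEquality as ≡ using (_≡_)
  open import Relation.Nullary using (yes; no)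

  open CommutativeRing R
  open import Algebra.Properties.Ring ring using (-0#≈0#; x≈y⇒x∙y⁻¹≈ε)
  open import Algebra.Definitions.RawSemiring (Semiring.rawSemiring semiring) using (_∣_)
  open import Relation.Binary.Reasoning.Setoid setoid
  open _-Raw-AlmostCommutative⟶_ φ using (⟦_⟧)

  private
    coeff? : WeaklyDecidable (λ p q → ⟦ p ⟧ ≈ ⟦ q ⟧)
    coeff? p q with p ℚ.≟ q
    ... | yes ≡.refl = just refl
    ... | no _       = nothing

  open import Algebra.Solver.Ring (CommutativeRing.rawRing ℚ.+-*-commutativeRing) (fromCommutativeRing R) φ coeff?
    using (solve; _:=_; con; _:+_; _:*_; _:-_; :-_)

  -- The solver evaluates constants through ⟦_⟧, so the unit is written ⟦ 1ℚ ⟧ rather than 1#.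
  discriminant : Carrier → Carrier → Carrier → Carrier
  discriminant t s z =
    ⟦ 1ℚ ⟧ - ⟦ + 2 / 1 ⟧ * (z + s * z)
    + (z * z - ⟦ + 4 / 1 ⟧ * (t * (z * z)) + ⟦ + 2 / 1 ⟧ * (s * (z * z)) + s * s * (z * z))

  discRoot : Carrier → Carrier → Carrier → Carrier → Carrier
  discRoot t s z G = ⟦ 1ℚ ⟧ + z - s * z - ⟦ + 2 / 1 ⟧ * (z * G)

  -- With H = G − 1, discRoot² − discriminant = −4z (H − z(t + H) − z(s + H)H), and this last
  -- factor is the combination of the residuals of the two functional equations displayed here.
  discRoot-square-residual : ∀ t s z G Y →
    discRoot t s z G * discRoot t s z G ≈
    discriminant t s z - ⟦ + 4 / 1 ⟧ * z *
      ((⟦ 1ℚ ⟧ - z * (s + (G - ⟦ 1ℚ ⟧))) * (G - (⟦ 1ℚ ⟧ + z * ((t + (G - ⟦ 1ℚ ⟧)) * Y)))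
       + z * (t + (G - ⟦ 1ℚ ⟧)) * (Y - (⟦ 1ℚ ⟧ + z * ((s + (G - ⟦ 1ℚ ⟧)) * Y))))
  discRoot-square-residual = solve 5 (λ t s z G Y →
    let T = con 1ℚ :+ z :- s :* z :- con (+ 2 / 1) :* (z :* G)
        D = con 1ℚ :- con (+ 2 / 1) :* (z :+ s :* z)
            :+ (z :* z :- con (+ 4 / 1) :* (t :* (z :* z)) :+ con (+ 2 / 1) :* (s :* (z :* z)) :+ s :* s :* (z :* z))
        H = G :- con 1ℚ
    in T :* T := D :- con (+ 4 / 1) :* z :*
         ((con 1ℚ :- z :* (s :+ H)) :* (G :- (con 1ℚ :+ z :* ((t :+ H) :* Y)))
          :+ z :* (t :+ H) :* (Y :- (con 1ℚ :+ z :* ((s :+ H) :* Y)))))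
    refl

  discRoot-square : ∀ {t s z G Y} →
    G ≈ ⟦ 1ℚ ⟧ + z * ((t + (G - ⟦ 1ℚ ⟧)) * Y) →
    Y ≈ ⟦ 1ℚ ⟧ + z * ((s + (G - ⟦ 1ℚ ⟧)) * Y) →
    discRoot t s z G * discRoot t s z G ≈ discriminant t s z
  discRoot-square {t} {s} {z} {G} {Y} G-eq Y-eq = begin
    discRoot t s z G * discRoot t s z G
      ≈⟨ discRoot-square-residual t s z G Y ⟩
    discriminant t s z - ⟦ + 4 / 1 ⟧ * z * (a * (G - G′) + b * (Y - Y′))
      ≈⟨ +-congˡ (-‿cong (*-congˡ (+-cong (*-congˡ (x≈y⇒x∙y⁻¹≈ε G-eq)) (*-congˡ (x≈y⇒x∙y⁻¹≈ε Y-eq))))) ⟩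
    discriminant t s z - ⟦ + 4 / 1 ⟧ * z * (a * 0# + b * 0#)
      ≈⟨ +-congˡ (-‿cong (*-congˡ (trans (+-cong (zeroʳ a) (zeroʳ b)) (+-identityʳ 0#)))) ⟩
    discriminant t s z - ⟦ + 4 / 1 ⟧ * z * 0#
      ≈⟨ +-congˡ (trans (-‿cong (zeroʳ _)) -0#≈0#) ⟩
    discriminant t s z + 0#
      ≈⟨ +-identityʳ _ ⟩
    discriminant t s z ∎
    where
    a b G′ Y′ : Carrier
    a  = ⟦ 1ℚ ⟧ - z * (s + (G - ⟦ 1ℚ ⟧))
    b  = z * (t + (G - ⟦ 1ℚ ⟧))
    G′ = ⟦ 1ℚ ⟧ + z * ((t + (G - ⟦ 1ℚ ⟧)) * Y)
    Y′ = ⟦ 1ℚ ⟧ + z * ((s + (G - ⟦ 1ℚ ⟧)) * Y)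

  z∣discRoot-1 : ∀ t s z G → z ∣ discRoot t s z G - ⟦ 1ℚ ⟧
  z∣discRoot-1 t s z G = record { quotient = ⟦ 1ℚ ⟧ - s - ⟦ + 2 / 1 ⟧ * G ; equality = solve 4 (λ t s z G →
    (con 1ℚ :- s :- con (+ 2 / 1) :* G) :* z := con 1ℚ :+ z :- s :* z :- con (+ 2 / 1) :* (z :* G) :- con 1ℚ)
    refl t s z G }

  z∣discriminant-1 : ∀ t s z → z ∣ discriminant t s z - ⟦ 1ℚ ⟧
  z∣discriminant-1 t s z = record
    { quotient = z * (⟦ 1ℚ ⟧ - ⟦ + 4 / 1 ⟧ * t + ⟦ + 2 / 1 ⟧ * s + s * s) - ⟦ + 2 / 1 ⟧ * (⟦ 1ℚ ⟧ + s)
    ; equality = solve 3 (λ t s z →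
      (z :* (con 1ℚ :- con (+ 4 / 1) :* t :+ con (+ 2 / 1) :* s :+ s :* s) :- con (+ 2 / 1) :* (con 1ℚ :+ s)) :* z
      := con 1ℚ :- con (+ 2 / 1) :* (z :+ s :* z)
         :+ (z :* z :- con (+ 4 / 1) :* (t :* (z :* z)) :+ con (+ 2 / 1) :* (s :* (z :* z)) :+ s :* s :* (z :* z))
         :- con 1ℚ)
    refl t s z }

  numerator-discRoot : ∀ t s z G → ⟦ 1ℚ ⟧ + z - s * z - discRoot t s z G ≈ z * (G + G)
  numerator-discRoot = solve 4 (λ t s z G →
    con 1ℚ :+ z :- s :* z :- (con 1ℚ :+ z :- s :* z :- con (+ 2 / 1) :* (z :* G)) := z :* (G :+ G))
    refl

  difference-of-squares-≈0 : ∀ {x y d} → x * x ≈ d → y * y ≈ d → (x - y) * (x + y) ≈ 0#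
  difference-of-squares-≈0 {x} {y} {d} x²≈d y²≈d = begin
    (x - y) * (x + y)  ≈⟨ solve 2 (λ x y → (x :- y) :* (x :+ y) := x :* x :- y :* y) refl x y ⟩
    x * x - y * y      ≈⟨ +-cong x²≈d (-‿cong y²≈d) ⟩
    d - d              ≈⟨ -‿inverseʳ d ⟩
    0#                 ∎

module BinomialHalf where

  open import Data.Nat as ℕ using (ℕ; zero; suc; _∸_)
  open import Data.Nat.Properties using (m∸[m∸n]≡n; m+[n∸m]≡n)
  open import Data.Integer as ℤ using (+_)
  open import Data.Rational using (ℚ; _/_; _+_; _*_; _-_; -_; 0ℚ; 1ℚ; ½; toℚᵘ)
  import Data.Rational.Properties as ℚ
  import Data.Rational.Unnormalised as ℚᵘ
  import Data.Rational.Unnormalised.Properties as ℚᵘ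
  open import Data.Maybe using (nothing)
  open import Relation.Binary.PropositionalEquality
  open import Tactic.RingSolver using (solve-∀)
  import Tactic.RingSolver.Core.AlmostCommutativeRing as Reflective
  import Data.Integer.Tactic.RingSolver as ℤ-Solver

  open import Defs using (binHalf)
  open FiniteSum ℚ.+-*-commutativeRing
  open PowerSeries ℚ.+-*-commutativeRing using (_*ₛ_; _+ₛ_; _≋_; const; X)

  private
    ℚ-ring = Reflective.fromCommutativeRing ℚ.+-*-commutativeRing (λ _ → nothing)

  toℚ : ℕ → ℚ
  toℚ k = + k / 1

  toℚ-suc : ∀ k → toℚ (suc k) ≡ 1ℚ + toℚ k
  toℚ-suc k = ℚ.toℚᵘ-injective (begin
    toℚᵘ (toℚ (suc k))                 ≈⟨ ℚ.toℚᵘ-fromℚᵘ (ℚᵘ.mkℚᵘ (+ suc k) 0) ⟩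
    ℚᵘ.mkℚᵘ (+ suc k) 0                ≈⟨ ℚᵘ.*≡* (numerators (+ k)) ⟩
    ℚᵘ.1ℚᵘ ℚᵘ.+ ℚᵘ.mkℚᵘ (+ k) 0        ≈⟨ ℚᵘ.+-congʳ ℚᵘ.1ℚᵘ (ℚ.toℚᵘ-fromℚᵘ (ℚᵘ.mkℚᵘ (+ k) 0)) ⟨
    ℚᵘ.1ℚᵘ ℚᵘ.+ toℚᵘ (toℚ k)           ≈⟨ ℚ.toℚᵘ-homo-+ 1ℚ (toℚ k) ⟨
    toℚᵘ (1ℚ + toℚ k)                  ∎)
    where
    open ℚᵘ.≃-Reasoning
    numerators : ∀ K → (+ 1 ℤ.+ K) ℤ.* (+ 1 ℤ.* + 1) ≡ (+ 1 ℤ.* + 1 ℤ.+ K ℤ.* + 1) ℤ.* + 1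
    numerators = ℤ-Solver.solve-∀

  toℚ-suc-*-inverse : ∀ k → toℚ (suc k) * (+ 1 / suc k) ≡ 1ℚ
  toℚ-suc-*-inverse k = ℚ.toℚᵘ-injective (begin
    toℚᵘ (toℚ (suc k) * (+ 1 / suc k))
      ≈⟨ ℚ.toℚᵘ-homo-* (toℚ (suc k)) (+ 1 / suc k) ⟩
    toℚᵘ (toℚ (suc k)) ℚᵘ.* toℚᵘ (+ 1 / suc k)
      ≈⟨ ℚᵘ.*-cong (ℚ.toℚᵘ-fromℚᵘ (ℚᵘ.mkℚᵘ (+ suc k) 0)) (ℚ.toℚᵘ-fromℚᵘ (ℚᵘ.mkℚᵘ (+ 1) k)) ⟩
    ℚᵘ.mkℚᵘ (+ suc k) 0 ℚᵘ.* ℚᵘ.mkℚᵘ (+ 1) k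
      ≈⟨ ℚᵘ.*≡* (numerators (+ suc k)) ⟩
    ℚᵘ.1ℚᵘ ∎)
    where
    open ℚᵘ.≃-Reasoning
    numerators : ∀ K → (K ℤ.* + 1) ℤ.* + 1 ≡ + 1 ℤ.* (+ 1 ℤ.* K)
    numerators = ℤ-Solver.solve-∀

  toℚ-+ : ∀ m n → toℚ (m ℕ.+ n) ≡ toℚ m + toℚ n
  toℚ-+ zero    n = sym (ℚ.+-identityˡ (toℚ n))
  toℚ-+ (suc m) n = begin
    toℚ (suc (m ℕ.+ n))   ≡⟨ toℚ-suc (m ℕ.+ n) ⟩
    1ℚ + toℚ (m ℕ.+ n)    ≡⟨ cong (λ q → 1ℚ + q) (toℚ-+ m n) ⟩
    1ℚ + (toℚ m + toℚ n)  ≡⟨ ℚ.+-assoc 1ℚ (toℚ m) (toℚ n) ⟨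
    1ℚ + toℚ m + toℚ n    ≡⟨ cong (_+ toℚ n) (toℚ-suc m) ⟨
    toℚ (suc m) + toℚ n   ∎
    where open ≡-Reasoning

  half-sum : ∀ q → ½ * (q + q) ≡ q
  half-sum q = trans (halve ½ q) (ℚ.*-identityˡ q)
    where
    halve : ∀ h q → h * (q + q) ≡ (h + h) * q
    halve = solve-∀ ℚ-ring

  binHalf-rec : ∀ k → toℚ (suc k) * binHalf (suc k) ≡ (½ - toℚ k) * binHalf k
  binHalf-rec k = begin
    toℚ (suc k) * (binHalf k * ((½ - toℚ k) * (+ 1 / suc k)))  ≡⟨ shuffle (toℚ (suc k)) (binHalf k) (½ - toℚ k) (+ 1 / suc k) ⟩
    (½ - toℚ k) * binHalf k * (toℚ (suc k) * (+ 1 / suc k))    ≡⟨ cong ((½ - toℚ k) * binHalf k *_) (toℚ-suc-*-inverse k) ⟩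
    (½ - toℚ k) * binHalf k * 1ℚ                               ≡⟨ ℚ.*-identityʳ _ ⟩
    (½ - toℚ k) * binHalf k                                    ∎
    where
    open ≡-Reasoning
    shuffle : ∀ a b c d → a * (b * (c * d)) ≡ c * b * (a * d)
    shuffle = solve-∀ ℚ-ring

  -- For the self-convolution c of binHalf and d k = Σ a · binHalf a · binHalf (k − a), the symmetry
  -- a ↔ k − a gives 2 d k = k c k and binHalf-rec gives d (k + 1) = ½ c k − d k, hence
  -- (k + 1) c (k + 1) = (1 − k) c k: the sequence c is 1, 1, 0, 0, …
  private
    conv weightedConv : ℕ → ℚ
    conv k = (binHalf *ₛ binHalf) k
    weightedConv k = sumTo k (λ a → toℚ a * (binHalf a * binHalf (k ∸ a)))

    weightedConv-double : ∀ k → weightedConv k + weightedConv k ≡ toℚ k * conv k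
    weightedConv-double k = begin
      weightedConv k + weightedConv k
        ≡⟨ cong (λ q → weightedConv k + q) (sym (sum-reverse k _)) ⟩
      weightedConv k + sumTo k (λ a → toℚ (k ∸ a) * (binHalf (k ∸ a) * binHalf (k ∸ (k ∸ a))))
        ≡⟨ cong (λ q → weightedConv k + q) (sum-cong-≤ k λ a a≤k → cong (toℚ (k ∸ a) *_)
             (trans (cong (λ b → binHalf (k ∸ a) * binHalf b) (m∸[m∸n]≡n a≤k)) (ℚ.*-comm (binHalf (k ∸ a)) (binHalf a)))) ⟩
      weightedConv k + sumTo k (λ a → toℚ (k ∸ a) * (binHalf a * binHalf (k ∸ a)))
        ≡⟨ sum-+ k _ _ ⟨
      sumTo k (λ a → toℚ a * (binHalf a * binHalf (k ∸ a)) + toℚ (k ∸ a) * (binHalf a * binHalf (k ∸ a)))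
        ≡⟨ sum-cong-≤ k (λ a a≤k → trans (sym (ℚ.*-distribʳ-+ _ (toℚ a) (toℚ (k ∸ a))))
             (cong (_* (binHalf a * binHalf (k ∸ a))) (trans (sym (toℚ-+ a (k ∸ a))) (cong toℚ (m+[n∸m]≡n a≤k))))) ⟩
      sumTo k (λ a → toℚ k * (binHalf a * binHalf (k ∸ a)))
        ≡⟨ *-distribˡ-sum k (toℚ k) _ ⟨
      toℚ k * conv k ∎
      where open ≡-Reasoning

    weightedConv-suc : ∀ k → weightedConv (suc k) ≡ ½ * conv k - weightedConv k
    weightedConv-suc k = begin
      weightedConv (suc k)
        ≡⟨ sum-unfoldˡ k _ ⟩
      toℚ 0 * (binHalf 0 * binHalf (suc k)) + sumTo k (λ a → toℚ (suc a) * (binHalf (suc a) * binHalf (k ∸ a)))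
        ≡⟨ cong₂ _+_ (ℚ.*-zeroˡ (binHalf 0 * binHalf (suc k))) (sum-cong k λ a →
             trans (sym (ℚ.*-assoc (toℚ (suc a)) (binHalf (suc a)) (binHalf (k ∸ a))))
             (trans (cong (_* binHalf (k ∸ a)) (binHalf-rec a)) (expand ½ (toℚ a) (binHalf a) (binHalf (k ∸ a))))) ⟩
      0ℚ + sumTo k (λ a → ½ * (binHalf a * binHalf (k ∸ a)) + - (toℚ a * (binHalf a * binHalf (k ∸ a))))
        ≡⟨ ℚ.+-identityˡ _ ⟩
      sumTo k (λ a → ½ * (binHalf a * binHalf (k ∸ a)) + - (toℚ a * (binHalf a * binHalf (k ∸ a))))
        ≡⟨ sum-+ k _ _ ⟩
      sumTo k (λ a → ½ * (binHalf a * binHalf (k ∸ a))) + sumTo k (λ a → - (toℚ a * (binHalf a * binHalf (k ∸ a))))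
        ≡⟨ cong₂ _+_ (sym (*-distribˡ-sum k ½ _)) (sym (-‿sum k _)) ⟩
      ½ * conv k - weightedConv k ∎
      where
      open ≡-Reasoning
      expand : ∀ h i b c → (h - i) * b * c ≡ h * (b * c) + - (i * (b * c))
      expand = solve-∀ ℚ-ring

    conv-rec : ∀ k → toℚ (suc k) * conv (suc k) ≡ (1ℚ - toℚ k) * conv k
    conv-rec k = begin
      toℚ (suc k) * conv (suc k)                             ≡⟨ weightedConv-double (suc k) ⟨
      weightedConv (suc k) + weightedConv (suc k)            ≡⟨ cong₂ _+_ (weightedConv-suc k) (weightedConv-suc k) ⟩
      (½ * conv k - weightedConv k) + (½ * conv k - weightedConv k)
                                                             ≡⟨ regroup ½ (conv k) (weightedConv k) ⟩
      (½ + ½) * conv k - (weightedConv k + weightedConv k)   ≡⟨ cong (λ q → (½ + ½) * conv k - q) (weightedConv-double k) ⟩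
      1ℚ * conv k - toℚ k * conv k                           ≡⟨ factor (toℚ k) (conv k) ⟩
      (1ℚ - toℚ k) * conv k                                  ∎
      where
      open ≡-Reasoning
      regroup : ∀ h c d → (h * c - d) + (h * c - d) ≡ (h + h) * c - (d + d)
      regroup = solve-∀ ℚ-ring
      factor : ∀ i c → 1ℚ * c - i * c ≡ (1ℚ - i) * c
      factor = solve-∀ ℚ-ring

    toℚ-suc-*-cancel : ∀ k x → toℚ (suc k) * x ≡ 0ℚ → x ≡ 0ℚ
    toℚ-suc-*-cancel k x kx≡0 = begin
      x                                    ≡⟨ ℚ.*-identityˡ x ⟨
      1ℚ * x                               ≡⟨ cong (_* x) (toℚ-suc-*-inverse k) ⟨
      toℚ (suc k) * (+ 1 / suc k) * x      ≡⟨ swap (toℚ (suc k)) (+ 1 / suc k) x ⟩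
      (+ 1 / suc k) * (toℚ (suc k) * x)    ≡⟨ cong ((+ 1 / suc k) *_) kx≡0 ⟩
      (+ 1 / suc k) * 0ℚ                   ≡⟨ ℚ.*-zeroʳ (+ 1 / suc k) ⟩
      0ℚ                                   ∎
      where
      open ≡-Reasoning
      swap : ∀ a r x → a * r * x ≡ r * (a * x)
      swap = solve-∀ ℚ-ring

    conv-1 : conv 1 ≡ 1ℚ
    conv-1 = trans (sym (ℚ.*-identityˡ (conv 1))) (conv-rec 0)

    conv-2+ : ∀ k → conv (suc (suc k)) ≡ 0ℚ
    conv-2+ zero    = toℚ-suc-*-cancel 1 (conv 2) (trans (conv-rec 1) (cong ((1ℚ - toℚ 1) *_) conv-1))
    conv-2+ (suc k) = toℚ-suc-*-cancel (suc (suc k)) (conv (suc (suc (suc k))))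
      (trans (conv-rec (suc (suc k))) (trans (cong ((1ℚ - toℚ (suc (suc k))) *_) (conv-2+ k)) (ℚ.*-zeroʳ (1ℚ - toℚ (suc (suc k))))))

  binHalf-square : binHalf *ₛ binHalf ≋ const 1ℚ +ₛ X
  binHalf-square zero                = refl
  binHalf-square (suc zero)          = conv-1
  binHalf-square (suc (suc k))       = conv-2+ k

module Trivariate where

  open import Algebra.Solver.Ring.AlmostCommutativeRing using (-raw-almostCommutative⟶)
  open import Data.Bool using (true; false)
  open import Data.Nat as ℕ using (ℕ; zero; suc; _∸_; _≡ᵇ_)
  open import Data.Rational as ℚ using (ℚ; _*_; 1ℚ)
  import Data.Rational.Properties as ℚ
  open import Relation.Binary.PropositionalEquality as ≡ using (_≡_; refl; cong; trans; sym)

  open import Defs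
  open BinomialHalf using (binHalf-square)

  private
    module Σℚ = FiniteSum ℚ.+-*-commutativeRing

  -- Series in t, s, z are series in z over series in t over series in s: the coefficient of
  -- z^n t^i s^j of F is F n i j, while Defs indexes it as i j n.
  module Sˢ = PowerSeries ℚ.+-*-commutativeRing
  module Sᵗ = PowerSeries Sˢ.powerSeriesRing
  module Sᶻ = PowerSeries Sᵗ.powerSeriesRing

  ℚ⟦s,t⟧ : CommutativeRing _ _
  ℚ⟦s,t⟧ = Sᵗ.powerSeriesRing

  ℚ⟦s,t,z⟧ : CommutativeRing _ _
  ℚ⟦s,t,z⟧ = Sᶻ.powerSeriesRing

  scalarᵗ : CommutativeRing.rawRing ℚ.+-*-commutativeRing -Raw-AlmostCommutative⟶ fromCommutativeRing ℚ⟦s,t⟧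
  scalarᵗ = Sᵗ.const-homomorphism (Sˢ.const-homomorphism (-raw-almostCommutative⟶ (fromCommutativeRing ℚ.+-*-commutativeRing)))

  scalar : CommutativeRing.rawRing ℚ.+-*-commutativeRing -Raw-AlmostCommutative⟶ fromCommutativeRing ℚ⟦s,t,z⟧
  scalar = Sᶻ.const-homomorphism scalarᵗ

  open _-Raw-AlmostCommutative⟶_ scalar using (⟦_⟧)

  embed : Series → Sᶻ.Series
  embed f n i j = f i j n

  leafWeight : ℕ → ℕ → Sᵗ.Series
  leafWeight a b = Sᵗ.monomial a (Sˢ.monomial b 1ℚ)

  monomial³ : ℕ → ℕ → ℕ → Sᶻ.Series
  monomial³ a b c = Sᶻ.monomial c (leafWeight a b)

  private
    sumTo≡ : ∀ n f → sumTo n f ≡ Σℚ.sumTo n f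
    sumTo≡ zero    f = refl
    sumTo≡ (suc n) f = cong (ℚ._+ f (suc n)) (sumTo≡ n f)

    *-coefficient : ∀ F G n i j → (F Sᶻ.*ₛ G) n i j ≡
      Σℚ.sumTo n (λ c → Σℚ.sumTo i (λ a → Σℚ.sumTo j (λ b → F c a b * G (n ∸ c) (i ∸ a) (j ∸ b))))
    *-coefficient F G n i j =
      trans (≡.cong-app (Sᵗ.sumTo-apply n _ i) j) (trans (Sˢ.sumTo-apply n _ j) (Σℚ.sum-cong n λ c → Sˢ.sumTo-apply i _ j))

  embed-⊛ : ∀ f g → embed (f ⊛ g) Sᶻ.≋ embed f Sᶻ.*ₛ embed g
  embed-⊛ f g n i j = begin
    sumTo i (λ a → sumTo j (λ b → sumTo n (λ c → T a b c)))
      ≡⟨ trans (sumTo≡ i _) (Σℚ.sum-cong i λ a → trans (sumTo≡ j _) (Σℚ.sum-cong j λ b → sumTo≡ n _)) ⟩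
    Σℚ.sumTo i (λ a → Σℚ.sumTo j (λ b → Σℚ.sumTo n (λ c → T a b c)))
      ≡⟨ Σℚ.sum-cong i (λ a → Σℚ.sum-comm j n _) ⟩
    Σℚ.sumTo i (λ a → Σℚ.sumTo n (λ c → Σℚ.sumTo j (λ b → T a b c)))
      ≡⟨ Σℚ.sum-comm i n _ ⟩
    Σℚ.sumTo n (λ c → Σℚ.sumTo i (λ a → Σℚ.sumTo j (λ b → T a b c)))
      ≡⟨ *-coefficient (embed f) (embed g) n i j ⟨
    (embed f Sᶻ.*ₛ embed g) n i j ∎
    where
    open ≡.≡-Reasoning
    T : ℕ → ℕ → ℕ → ℚ
    T a b c = f a b c * g (i ∸ a) (j ∸ b) (n ∸ c)

  embed-scale : ∀ q f → embed (scale q f) Sᶻ.≋ ⟦ q ⟧ Sᶻ.*ₛ embed f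
  embed-scale q f n i j = sym (trans (Sᶻ.const-*ˡ _ (embed f) n i j)
    (trans (Sᵗ.const-*ˡ _ (embed f n) i j) (Sˢ.const-*ˡ q (embed f n i) j)))

  embed-mono : ∀ a b c → embed (mono a b c) Sᶻ.≋ monomial³ a b c
  embed-mono a b c n i j with n ≡ᵇ c
  ... | false with i ≡ᵇ a
  ...   | false = refl
  ...   | true with j ≡ᵇ b
  ...     | true  = refl
  ...     | false = refl
  embed-mono a b c n i j | true with i ≡ᵇ a
  ...   | false = refl
  ...   | true with j ≡ᵇ b
  ...     | true  = refl
  ...     | false = refl

  module 𝔸 = CommutativeRing ℚ⟦s,t⟧
  module 𝕊 = CommutativeRing ℚ⟦s,t,z⟧

  leafWeight-* : ∀ a b a′ b′ →
    CommutativeRing._≈_ ℚ⟦s,t⟧ (leafWeight a b Sᵗ.*ₛ leafWeight a′ b′) (leafWeight (a ℕ.+ a′) (b ℕ.+ b′))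
  leafWeight-* a b a′ b′ i j = trans (Sᵗ.monomial-* a a′ _ _ i j)
    (Sᵗ.monomial-cong (a ℕ.+ a′) (λ j → trans (Sˢ.monomial-* b b′ 1ℚ 1ℚ j)
                                              (Sˢ.monomial-cong (b ℕ.+ b′) (ℚ.*-identityˡ 1ℚ) j)) i j)

  monomial³-* : ∀ a b c a′ b′ c′ →
    monomial³ a b c 𝕊.* monomial³ a′ b′ c′ 𝕊.≈ monomial³ (a ℕ.+ a′) (b ℕ.+ b′) (c ℕ.+ c′)
  monomial³-* a b c a′ b′ c′ n i j =
    trans (Sᶻ.monomial-* c c′ _ _ n i j) (Sᶻ.monomial-cong (c ℕ.+ c′) (leafWeight-* a b a′ b′) n i j)

  embed-pow : ∀ f k → embed (pow f k) 𝕊.≈ embed f Sᶻ.^ₛ k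
  embed-pow f zero    = embed-mono 0 0 0
  embed-pow f (suc k) = 𝕊.trans (embed-⊛ f (pow f k)) (𝕊.*-congˡ {embed f} (embed-pow f k))

  private
    module ψ = _-Raw-AlmostCommutative⟶_ scalarᵗ

    ψ-sum : ∀ n f → ψ.⟦ Σℚ.sumTo n f ⟧ 𝔸.≈ Sᵗ.Σₛ.sumTo n (λ a → ψ.⟦ f a ⟧)
    ψ-sum zero    f = 𝔸.refl
    ψ-sum (suc n) f = 𝔸.trans (ψ.+-homo _ _) (𝔸.+-congʳ (ψ-sum n f))

    ψ-monomial : ∀ m q k → ψ.⟦ Sˢ.monomial m q k ⟧ 𝔸.≈ Sᶻ.monomial m ψ.⟦ q ⟧ k
    ψ-monomial m q k with k ≡ᵇ m
    ... | true  = 𝔸.refl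
    ... | false = ψ.0-homo

  binHalfᵗ : Sᶻ.Series
  binHalfᵗ k = ψ.⟦ binHalf k ⟧

  binHalfᵗ-square : binHalfᵗ Sᶻ.*ₛ binHalfᵗ 𝕊.≈ 𝕊.1# 𝕊.+ Sᶻ.X
  binHalfᵗ-square k = begin
    Sᵗ.Σₛ.sumTo k (λ a → ψ.⟦ binHalf a ⟧ 𝔸.* ψ.⟦ binHalf (k ∸ a) ⟧)
      ≈⟨ Sᵗ.Σₛ.sum-cong k (λ a → 𝔸.sym (ψ.*-homo _ _)) ⟩
    Sᵗ.Σₛ.sumTo k (λ a → ψ.⟦ binHalf a * binHalf (k ∸ a) ⟧)
      ≈⟨ ψ-sum k _ ⟨
    ψ.⟦ (binHalf Sˢ.*ₛ binHalf) k ⟧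
      ≡⟨ cong ψ.⟦_⟧ (binHalf-square k) ⟩
    ψ.⟦ Sˢ.const 1ℚ k ℚ.+ Sˢ.monomial 1 1ℚ k ⟧
      ≈⟨ ψ.+-homo _ _ ⟩
    ψ.⟦ Sˢ.const 1ℚ k ⟧ 𝔸.+ ψ.⟦ Sˢ.monomial 1 1ℚ k ⟧
      ≈⟨ 𝔸.+-cong (ψ-monomial 0 1ℚ k) (ψ-monomial 1 1ℚ k) ⟩
    𝕊.1# k 𝔸.+ Sᶻ.X k ∎
    where open import Relation.Binary.Reasoning.Setoid 𝔸.setoid

  embed-sqrt1 : ∀ D → embed (sqrt1 D) 𝕊.≈ binHalfᵗ Sᶻ.∘ₛ embed (D ⊖ one)
  embed-sqrt1 D n i j = begin
    sumTo n (λ k → binHalf k * pow (D ⊖ one) k i j n)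
      ≡⟨ sumTo≡ n _ ⟩
    Σℚ.sumTo n (λ k → binHalf k * embed (pow (D ⊖ one) k) n i j)
      ≡⟨ Σℚ.sum-cong n (λ k → cong (binHalf k *_) (embed-pow (D ⊖ one) k n i j)) ⟩
    Σℚ.sumTo n (λ k → binHalf k * (u Sᶻ.^ₛ k) n i j)
      ≡⟨ Σℚ.sum-cong n (λ k → sym (trans (Sᵗ.const-*ˡ _ ((u Sᶻ.^ₛ k) n) i j)
                                        (Sˢ.const-*ˡ (binHalf k) ((u Sᶻ.^ₛ k) n i) j))) ⟩
    Σℚ.sumTo n (λ k → (binHalfᵗ k Sᵗ.*ₛ (u Sᶻ.^ₛ k) n) i j)
      ≡⟨ trans (≡.cong-app (Sᵗ.sumTo-apply n _ i) j) (Sˢ.sumTo-apply n _ j) ⟨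
    (binHalfᵗ Sᶻ.∘ₛ u) n i j ∎
    where
    open ≡.≡-Reasoning
    u = embed (D ⊖ one)

module ListEnumeration {a} {A : Set a} where

  open import Data.Fin using (Fin; zero; suc)
  open import Data.List using (List; []; _∷_; _++_; length; lookup)
  open import Data.List.Membership.Propositional using (_∈_)
  open import Data.List.Membership.Propositional.Properties using (∈-++⁺ˡ; ∈-++⁺ʳ; ∈-++⁻; ∈-lookup)
  open import Data.List.Relation.Unary.All as All using ()
  open import Data.List.Relation.Unary.Any using (here; there; index)
  open import Data.List.Relation.Unary.Any.Properties using (lookup-index)
  open import Data.List.Relation.Unary.AllPairs using (_∷_)
  open import Data.List.Relation.Unary.Unique.Propositional using (Unique)
  import Data.List.Relation.Unary.Unique.Propositional.Properties as Unique
  open import Data.Nat as ℕ using (ℕ; zero; suc; _≤_; z≤n)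
  open import Data.Nat.Properties using (≤-refl; m≤n⇒m≤1+n; ≤-pred; ≤∧≢⇒<; <-irrefl)
  open import Data.Product using (Σ; ∃; _×_; _,_)
  open import Data.Sum using (inj₁; inj₂)
  open import Function.Bundles using (_↔_; _⇔_; mk↔ₛ′; Equivalence)
  open import Relation.Binary.PropositionalEquality using (_≡_; refl; cong; cong₂; subst; sym; trans)
  open import Relation.Nullary using (¬_; yes; no; contradiction)
  open import Relation.Unary using (Irrelevant)

  index-lookup-unique : ∀ {xs : List A} → Unique xs → (i : Fin (length xs)) (p : lookup xs i ∈ xs) → index p ≡ i
  index-lookup-unique {_ ∷ _}  _             zero    (here _)  = refl
  index-lookup-unique {_ ∷ _}  (x∉xs ∷ _)    zero    (there p) = contradiction refl (All.lookup x∉xs p)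
  index-lookup-unique {_ ∷ xs} (x∉xs ∷ _)    (suc i) (here e)  = contradiction (sym e) (All.lookup x∉xs (∈-lookup {xs = xs} i))
  index-lookup-unique {_ ∷ _}  (_ ∷ unique) (suc i) (there p) = cong suc (index-lookup-unique unique i p)

  unique-enumeration : ∀ {p} {P : A → Set p} {xs : List A} → Unique xs → Irrelevant P →
                       (∀ {x} → x ∈ xs ⇔ P x) → Fin (length xs) ↔ Σ A P
  unique-enumeration {P = P} {xs} unique irrelevant ∈⇔P = mk↔ₛ′ to from to∘from from∘to
    where
    to : Fin (length xs) → Σ A P
    to i = lookup xs i , Equivalence.to ∈⇔P (∈-lookup i)
    from : Σ A P → Fin (length xs)
    from (x , px) = index (Equivalence.from ∈⇔P px)
    to∘from : ∀ y → to (from y) ≡ y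
    to∘from (x , px) = ,-≡ (sym (lookup-index (Equivalence.from ∈⇔P px)))
      where
      ,-≡ : ∀ {y} (y≡x : y ≡ x) {py} → (y , py) ≡ (x , px)
      ,-≡ refl = cong (x ,_) (irrelevant _ px)
    from∘to : ∀ i → from (to i) ≡ i
    from∘to i = index-lookup-unique unique i _

  concatUpTo : ℕ → (ℕ → List A) → List A
  concatUpTo zero    h = h 0
  concatUpTo (suc n) h = concatUpTo n h ++ h (suc n)

  ∈-concatUpTo⁺ : ∀ n h {a x} → a ≤ n → x ∈ h a → x ∈ concatUpTo n h
  ∈-concatUpTo⁺ zero    h z≤n x∈ = x∈
  ∈-concatUpTo⁺ (suc n) h {a} a≤1+n x∈ with a ℕ.≟ suc n
  ... | yes refl = ∈-++⁺ʳ (concatUpTo n h) x∈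
  ... | no a≢1+n = ∈-++⁺ˡ (∈-concatUpTo⁺ n h (≤-pred (≤∧≢⇒< a≤1+n a≢1+n)) x∈)

  ∈-concatUpTo⁻ : ∀ n h {x} → x ∈ concatUpTo n h → ∃ λ a → a ≤ n × x ∈ h a
  ∈-concatUpTo⁻ zero    h x∈ = 0 , z≤n , x∈
  ∈-concatUpTo⁻ (suc n) h x∈ with ∈-++⁻ (concatUpTo n h) x∈
  ... | inj₁ x∈′ = let a , a≤n , x∈ha = ∈-concatUpTo⁻ n h x∈′ in a , m≤n⇒m≤1+n a≤n , x∈ha
  ... | inj₂ x∈′ = suc n , ≤-refl , x∈′

  concatUpTo-cong : ∀ n {h h′} → (∀ a → a ≤ n → h a ≡ h′ a) → concatUpTo n h ≡ concatUpTo n h′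
  concatUpTo-cong zero    h≡h′ = h≡h′ 0 z≤n
  concatUpTo-cong (suc n) h≡h′ = cong₂ _++_ (concatUpTo-cong n λ a a≤n → h≡h′ a (m≤n⇒m≤1+n a≤n)) (h≡h′ (suc n) ≤-refl)

  concatUpTo-unique : ∀ n h (key : A → ℕ) → (∀ a → a ≤ n → Unique (h a)) → (∀ a {x} → x ∈ h a → key x ≡ a) →
                      Unique (concatUpTo n h)
  concatUpTo-unique zero    h key unique key≡ = unique 0 z≤n
  concatUpTo-unique (suc n) h key unique key≡ =
    Unique.++⁺ (concatUpTo-unique n h key (λ a a≤n → unique a (m≤n⇒m≤1+n a≤n)) key≡) (unique (suc n) ≤-refl) disjoint
    where
    disjoint : ∀ {x} → ¬ (x ∈ concatUpTo n h × x ∈ h (suc n))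
    disjoint (x∈ , x∈′) = let a , a≤n , x∈ha = ∈-concatUpTo⁻ n h x∈ in
      <-irrefl refl (subst (_≤ n) (trans (sym (key≡ a x∈ha)) (key≡ (suc n) x∈′)) a≤n)

module ListSum {c ℓ} (R : CommutativeRing c ℓ) where

  open import Data.List using (List; []; _∷_; _++_; map; cartesianProductWith)
  open import Data.List.Membership.Propositional using (_∈_)
  open import Data.List.Relation.Unary.Any using (here; there)
  open import Data.Nat using (zero; suc)
  open import Relation.Binary.PropositionalEquality as ≡ using (_≡_)

  open CommutativeRing R
  open import Relation.Binary.Reasoning.Setoid setoid
  open FiniteSum R using (sumTo)
  open ListEnumeration using (concatUpTo)

  module _ {a} {A : Set a} where

    sumList : List A → (A → Carrier) → Carrier
    sumList []       f = 0#
    sumList (x ∷ xs) f = f x + sumList xs f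

    sumList-cong : ∀ xs {f g} → (∀ {x} → x ∈ xs → f x ≈ g x) → sumList xs f ≈ sumList xs g
    sumList-cong []       f≈g = refl
    sumList-cong (x ∷ xs) f≈g = +-cong (f≈g (here ≡.refl)) (sumList-cong xs (λ x∈ → f≈g (there x∈)))

    sumList-++ : ∀ xs ys f → sumList (xs ++ ys) f ≈ sumList xs f + sumList ys f
    sumList-++ []       ys f = sym (+-identityˡ _)
    sumList-++ (x ∷ xs) ys f = trans (+-congˡ (sumList-++ xs ys f)) (sym (+-assoc _ _ _))

    *-distribˡ-sumList : ∀ xs x f → x * sumList xs f ≈ sumList xs (λ y → x * f y)
    *-distribˡ-sumList []       x f = zeroʳ x
    *-distribˡ-sumList (y ∷ xs) x f = trans (distribˡ x _ _) (+-congˡ (*-distribˡ-sumList xs x f))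

    sumList-concatUpTo : ∀ n h f → sumList (concatUpTo n h) f ≈ sumTo n (λ a → sumList (h a) f)
    sumList-concatUpTo zero    h f = refl
    sumList-concatUpTo (suc n) h f = trans (sumList-++ (concatUpTo n h) (h (suc n)) f) (+-congʳ (sumList-concatUpTo n h f))

  sumList-map : ∀ {a b} {A : Set a} {B : Set b} (g : A → B) xs f → sumList (map g xs) f ≡ sumList xs (λ x → f (g x))
  sumList-map g []       f = ≡.refl
  sumList-map g (x ∷ xs) f = ≡.cong (f (g x) +_) (sumList-map g xs f)

  sumList-cartesianProductWith : ∀ {a b d} {A : Set a} {B : Set b} {D : Set d} (_⊗_ : A → B → D) xs ys
    {h : D → Carrier} {f : A → Carrier} {g : B → Carrier} → (∀ x y → h (x ⊗ y) ≈ f x * g y) →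
    sumList (cartesianProductWith _⊗_ xs ys) h ≈ sumList xs f * sumList ys g
  sumList-cartesianProductWith _⊗_ []       ys         h≈fg = sym (zeroˡ _)
  sumList-cartesianProductWith _⊗_ (x ∷ xs) ys {h} {f} {g} h≈fg = begin
    sumList (map (x ⊗_) ys ++ cartesianProductWith _⊗_ xs ys) h
      ≈⟨ sumList-++ (map (x ⊗_) ys) _ h ⟩
    sumList (map (x ⊗_) ys) h + sumList (cartesianProductWith _⊗_ xs ys) h
      ≈⟨ +-cong (reflexive (sumList-map (x ⊗_) ys h)) (sumList-cartesianProductWith _⊗_ xs ys h≈fg) ⟩
    sumList ys (λ y → h (x ⊗ y)) + sumList xs f * sumList ys g
      ≈⟨ +-congʳ (trans (sumList-cong ys λ {y} _ → h≈fg x y) (sym (*-distribˡ-sumList ys (f x) g))) ⟩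
    f x * sumList ys g + sumList xs f * sumList ys g
      ≈⟨ distribʳ _ _ _ ⟨
    (f x + sumList xs f) * sumList ys g ∎

module PlaneTrees where

  open import Data.Fin using (Fin)
  open import Data.List using (List; []; _∷_; [_]; map; length; cartesianProductWith; filter)
  open import Data.List.Membership.Propositional using (_∈_)
  open import Data.List.Membership.Propositional.Properties
    using (∈-map⁺; ∈-map⁻; ∈-filter⁺; ∈-filter⁻; ∈-cartesianProductWith⁺; ∈-cartesianProductWith⁻)
  open import Data.List.Relation.Unary.All using ([])
  open import Data.List.Relation.Unary.Any using (here)
  open import Data.List.Relation.Unary.AllPairs using ([]; _∷_)
  open import Data.List.Relation.Unary.Unique.Propositional using (Unique)
  import Data.List.Relation.Unary.Unique.Propositional.Properties as Unique
  open import Data.Nat as ℕ using (ℕ; zero; suc; _∸_; _<_; s≤s)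
  open import Data.Nat.Properties
    using (≤-refl; ≤-<-trans; m≤m+n; m≤n+m; m+[n∸m]≡n; m+n∸m≡n; m∸n≤m; ≡-irrelevant)
  open import Data.Product using (_×_; _,_)
  open import Function.Bundles using (_↔_; mk⇔)
  open import Relation.Binary.PropositionalEquality using (_≡_; refl; cong; cong₂; subst; sym; trans)
  open import Relation.Nullary.Decidable using (_×-dec_)
  open import Relation.Unary using (Decidable)

  open import Defs using (PTree; node; edges; edgesL; old; young; TreesWith)
  open ListEnumeration

  Forest : Set
  Forest = List PTree

  graft : Forest → Forest → Forest
  graft ds cs = node ds ∷ cs

  graft-injective : ∀ {ds ds′ cs cs′} → graft ds cs ≡ graft ds′ cs′ → ds ≡ ds′ × cs ≡ cs′
  graft-injective refl = refl , refl

  -- The first argument is fuel: it only has to exceed the number of edges.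
  forests : ℕ → ℕ → List Forest
  forests zero     _       = []
  forests (suc f)  zero    = [ [] ]
  forests (suc f)  (suc n) = concatUpTo n λ a → cartesianProductWith graft (forests f a) (forests f (n ∸ a))

  forests-sound : ∀ f n {cs} → cs ∈ forests f n → edgesL cs ≡ n
  forests-sound (suc f) zero    (here refl) = refl
  forests-sound (suc f) (suc n) cs∈ =
    let a , a≤n , cs∈′ = ∈-concatUpTo⁻ n _ cs∈
        ds , cs′ , ds∈ , cs′∈ , cs≡ = ∈-cartesianProductWith⁻ graft (forests f a) (forests f (n ∸ a)) cs∈′
    in subst (λ cs → edgesL cs ≡ suc n) (sym cs≡)
         (cong suc (trans (cong₂ ℕ._+_ (forests-sound f a ds∈) (forests-sound f (n ∸ a) cs′∈)) (m+[n∸m]≡n a≤n)))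

  forests-complete : ∀ f cs → edgesL cs < f → cs ∈ forests f (edgesL cs)
  forests-complete (suc f) []             _          = here refl
  forests-complete (suc f) (node ds ∷ cs) (s≤s e<f) =
    ∈-concatUpTo⁺ (a ℕ.+ b) _ (m≤m+n a b)
      (subst (λ m → graft ds cs ∈ cartesianProductWith graft (forests f a) (forests f m)) (sym (m+n∸m≡n a b))
        (∈-cartesianProductWith⁺ graft (forests-complete f ds (≤-<-trans (m≤m+n a b) e<f))
                                       (forests-complete f cs (≤-<-trans (m≤n+m b a) e<f))))
    where
    a = edgesL ds
    b = edgesL cs

  forests-unique : ∀ f n → Unique (forests f n)
  forests-unique zero    n       = []
  forests-unique (suc f) zero    = [] ∷ []
  forests-unique (suc f) (suc n) = concatUpTo-unique n _ firstTreeEdges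
    (λ a _ → Unique.cartesianProductWith⁺ graft graft-injective (forests-unique f a) (forests-unique f (n ∸ a)))
    (λ a cs∈ → let ds , _ , ds∈ , _ , cs≡ = ∈-cartesianProductWith⁻ graft (forests f a) _ cs∈
               in trans (cong firstTreeEdges cs≡) (forests-sound f a ds∈))
    where
    firstTreeEdges : Forest → ℕ
    firstTreeEdges []             = 0
    firstTreeEdges (node ds ∷ _) = edgesL ds

  forests-fuel : ∀ f g n → n < f → n < g → forests f n ≡ forests g n
  forests-fuel (suc f) (suc g) zero    _         _         = refl
  forests-fuel (suc f) (suc g) (suc n) (s≤s n<f) (s≤s n<g) = concatUpTo-cong n λ a a≤n →
    cong₂ (cartesianProductWith graft)
      (forests-fuel f g a (≤-<-trans a≤n n<f) (≤-<-trans a≤n n<g))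
      (forests-fuel f g (n ∸ a) (≤-<-trans (m∸n≤m n a) n<f) (≤-<-trans (m∸n≤m n a) n<g))

  treesWithEdges : ℕ → List PTree
  treesWithEdges n = map node (forests (suc n) n)

  ∈-treesWithEdges⁺ : ∀ {T n} → edges T ≡ n → T ∈ treesWithEdges n
  ∈-treesWithEdges⁺ {node cs} refl = ∈-map⁺ node (forests-complete (suc (edgesL cs)) cs ≤-refl)

  ∈-treesWithEdges⁻ : ∀ {T n} → T ∈ treesWithEdges n → edges T ≡ n
  ∈-treesWithEdges⁻ {n = n} T∈ = let cs , cs∈ , T≡ = ∈-map⁻ node T∈ in
    trans (cong edges T≡) (forests-sound (suc n) n cs∈)

  treesWithEdges-unique : ∀ n → Unique (treesWithEdges n)
  treesWithEdges-unique n = Unique.map⁺ (λ { refl → refl }) (forests-unique (suc n) n)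

  LeafCounts : ℕ → ℕ → PTree → Set
  LeafCounts i j T = old T ≡ i × young T ≡ j

  leafCounts? : ∀ i j → Decidable (LeafCounts i j)
  leafCounts? i j T = old T ℕ.≟ i ×-dec young T ℕ.≟ j

  treesWith : ℕ → ℕ → ℕ → List PTree
  treesWith i j n = filter (leafCounts? i j) (treesWithEdges n)

  treesWith↔ : ∀ i j n → Fin (length (treesWith i j n)) ↔ TreesWith i j n
  treesWith↔ i j n = unique-enumeration (Unique.filter⁺ (leafCounts? i j) (treesWithEdges-unique n))
    (λ (o , y , e) (o′ , y′ , e′) → cong₂ _,_ (≡-irrelevant o o′) (cong₂ _,_ (≡-irrelevant y y′) (≡-irrelevant e e′)))
    (mk⇔ (λ T∈ → let T∈′ , o , y = ∈-filter⁻ (leafCounts? i j) T∈ in o , y , ∈-treesWithEdges⁻ T∈′)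
         (λ (o , y , e) → ∈-filter⁺ (leafCounts? i j) (∈-treesWithEdges⁺ e) (o , y)))

module GeneratingFunction where

  open import Data.List using (List; []; _∷_; cartesianProductWith; length; filter)
  open import Data.List.Properties using (filter-accept; filter-reject)
  open import Data.List.Membership.Propositional using (_∈_)
  open import Data.Nat as ℕ using (ℕ; zero; suc; _∸_; s≤s)
  open import Data.Nat.Properties using (≤-refl; m∸n≤m)
  open import Data.Product using (_,_)
  open import Data.Rational as ℚ using (1ℚ; 0ℚ)
  import Data.Rational.Properties as ℚ
  open import Relation.Nullary using (¬_; Dec; yes; no)
  open import Relation.Binary.PropositionalEquality as ≡ using (_≡_)

  open import Defs using (PTree; node; isLeaf; old; young; oldL; youngL)
  open PlaneTrees using (Forest; graft; forests; forests-fuel; forests-sound; treesWithEdges; treesWith; LeafCounts; leafCounts?)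
  open BinomialHalf using (toℚ; toℚ-suc)
  open Trivariate using (module Sˢ; module Sᵗ; module Sᶻ; ℚ⟦s,t⟧; ℚ⟦s,t,z⟧; leafWeight; leafWeight-*)

  open CommutativeRing ℚ⟦s,t⟧
  import Relation.Binary.Reasoning.Setoid setoid as ≈-Reasoning
  open import Algebra.Properties.Ring ring using (-0#≈0#)
  open ListSum ℚ⟦s,t⟧
  open FiniteSum ℚ⟦s,t⟧ using (sumTo; sum-cong; sum-cong-≤)
  private module 𝕊 = CommutativeRing ℚ⟦s,t,z⟧

  weight : PTree → Carrier
  weight T = leafWeight (old T) (young T)

  forestWeight : Forest → Carrier
  forestWeight cs = leafWeight (oldL cs) (youngL cs)

  -- A leaf child is old when it is the leftmost child and young otherwise.
  firstChildWeight laterChildWeight : PTree → Carrier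
  firstChildWeight c = leafWeight (isLeaf c ℕ.+ old c) (young c)
  laterChildWeight c = leafWeight (old c) (isLeaf c ℕ.+ young c)

  gf : (Forest → Carrier) → Sᶻ.Series
  gf F n = sumList (forests (suc n) n) F

  -- Y weighs the forests that follow a leftmost child, whose leaf roots are therefore young.
  G Y τ σ : Sᶻ.Series
  G = gf (λ cs → weight (node cs))
  Y = gf forestWeight
  τ = gf (λ cs → firstChildWeight (node cs))
  σ = gf (λ cs → laterChildWeight (node cs))

  gf-suc : ∀ {F} g h → (∀ ds cs → F (graft ds cs) ≈ g ds * h cs) → ∀ n → gf F (suc n) ≈ (gf g Sᶻ.*ₛ gf h) n
  gf-suc {F} g h F≈gh n = begin
    sumList (forests (suc (suc n)) (suc n)) F
      ≈⟨ sumList-concatUpTo n _ F ⟩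
    sumTo n (λ a → sumList (cartesianProductWith graft (forests (suc n) a) (forests (suc n) (n ∸ a))) F)
      ≈⟨ sum-cong n (λ a → sumList-cartesianProductWith graft (forests (suc n) a) _ F≈gh) ⟩
    sumTo n (λ a → sumList (forests (suc n) a) g * sumList (forests (suc n) (n ∸ a)) h)
      ≈⟨ sum-cong-≤ n (λ a a≤n → reflexive (≡.cong₂ (λ xs ys → sumList xs g * sumList ys h)
           (forests-fuel (suc n) (suc a) a (s≤s a≤n) ≤-refl)
           (forests-fuel (suc n) (suc (n ∸ a)) (n ∸ a) (s≤s (m∸n≤m n a)) ≤-refl))) ⟩
    sumTo n (λ a → gf g a * gf h (n ∸ a)) ∎
    where open ≈-Reasoning

  z : Sᶻ.Series
  z = Sᶻ.X

  private
    constant-term-of-z* : ∀ x F → (x Sᶻ.+ₛ z Sᶻ.*ₛ F) 0 ≈ x 0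
    constant-term-of-z* x F = trans (+-congˡ {x 0} (Sᶻ.X*ₛ-zero F)) (+-identityʳ (x 0))

    later-terms-of-z* : ∀ F n → (𝕊.1# Sᶻ.+ₛ z Sᶻ.*ₛ F) (suc n) ≈ F n
    later-terms-of-z* F n = trans (+-identityˡ _) (Sᶻ.X*ₛ-suc F n)

  G-equation : G 𝕊.≈ 𝕊.1# 𝕊.+ z 𝕊.* (τ 𝕊.* Y)
  G-equation zero    = sym (trans (constant-term-of-z* 𝕊.1# (τ 𝕊.* Y)) (sym (+-identityʳ 1#)))
  G-equation (suc n) = trans (gf-suc (λ ds → firstChildWeight (node ds)) forestWeight (λ ds cs → sym (leafWeight-* _ _ _ _)) n)
                             (sym (later-terms-of-z* (τ 𝕊.* Y) n))

  Y-equation : Y 𝕊.≈ 𝕊.1# 𝕊.+ z 𝕊.* (σ 𝕊.* Y)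
  Y-equation zero    = sym (trans (constant-term-of-z* 𝕊.1# (σ 𝕊.* Y)) (sym (+-identityʳ 1#)))
  Y-equation (suc n) = trans (gf-suc (λ ds → laterChildWeight (node ds)) forestWeight (λ ds cs → sym (leafWeight-* _ _ _ _)) n)
                             (sym (later-terms-of-z* (σ 𝕊.* Y) n))

  private
    gf-cong-nonempty : ∀ {F F′} → (∀ c cs → F (c ∷ cs) ≈ F′ (c ∷ cs)) → ∀ n → gf F (suc n) ≈ gf F′ (suc n)
    gf-cong-nonempty F≈F′ n = sumList-cong (forests (suc (suc n)) (suc n)) agree
      where
      agree : ∀ {cs} → cs ∈ forests (suc (suc n)) (suc n) → _
      agree {c ∷ cs} _   = F≈F′ c cs
      agree {[]}     cs∈ with () ← forests-sound (suc (suc n)) (suc n) cs∈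

    leaf-or-tree : ∀ a b {F} → F [] ≈ leafWeight a b → (∀ c cs → F (c ∷ cs) ≈ weight (node (c ∷ cs))) →
                   gf F 𝕊.≈ Sᶻ.const (leafWeight a b) 𝕊.+ (G 𝕊.- 𝕊.1#)
    leaf-or-tree a b {F} F[]≈ nonempty zero = begin
      gf F 0                                        ≈⟨ +-identityʳ (F []) ⟩
      F []                                          ≈⟨ F[]≈ ⟩
      leafWeight a b                                ≈⟨ +-identityʳ _ ⟨
      leafWeight a b + 0#                           ≈⟨ +-congˡ {leafWeight a b} (trans (+-congʳ { - 1#} (+-identityʳ 1#)) (-‿inverseʳ 1#)) ⟨
      leafWeight a b + (G 0 - 1#)                   ∎
      where open ≈-Reasoning
    leaf-or-tree a b {F} F[]≈ nonempty (suc n) = begin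
      gf F (suc n)                                  ≈⟨ gf-cong-nonempty nonempty n ⟩
      G (suc n)                                     ≈⟨ +-identityʳ _ ⟨
      G (suc n) + 0#                                ≈⟨ +-congˡ {G (suc n)} -0#≈0# ⟨
      G (suc n) - 0#                                ≈⟨ +-identityˡ _ ⟨
      0# + (G (suc n) - 0#)                         ∎
      where open ≈-Reasoning

  τ-equation : τ 𝕊.≈ Sᶻ.const (leafWeight 1 0) 𝕊.+ (G 𝕊.- 𝕊.1#)
  τ-equation = leaf-or-tree 1 0 refl (λ _ _ → refl)

  σ-equation : σ 𝕊.≈ Sᶻ.const (leafWeight 0 1) 𝕊.+ (G 𝕊.- 𝕊.1#)
  σ-equation = leaf-or-tree 0 1 refl (λ _ _ → refl)

  module _ (i j : ℕ) where

    private
      weight-at : ∀ T → LeafCounts i j T → weight T i j ≡ 1ℚ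
      weight-at T (≡.refl , ≡.refl) =
        ≡.trans (≡.cong-app (Sᵗ.monomial-at (old T) (Sˢ.monomial (young T) 1ℚ)) j) (Sˢ.monomial-at (young T) 1ℚ)

      weight-elsewhere : ∀ T → ¬ LeafCounts i j T → weight T i j ≡ 0ℚ
      weight-elsewhere T ¬counts with old T ℕ.≟ i
      ... | no old≢i = ≡.cong-app (Sᵗ.monomial-≢ _ (λ i≡old → old≢i (≡.sym i≡old))) j
      ... | yes ≡.refl = ≡.trans (≡.cong-app (Sᵗ.monomial-at (old T) (Sˢ.monomial (young T) 1ℚ)) j)
                                 (Sˢ.monomial-≢ 1ℚ (λ j≡young → ¬counts (≡.refl , ≡.sym j≡young)))

      sumList-weight : ∀ Ts → sumList Ts weight i j ≡ toℚ (length (filter (leafCounts? i j) Ts))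
      sumList-weight []       = ≡.refl
      sumList-weight (T ∷ Ts) = by-cases (leafCounts? i j T)
        where
        open ≡.≡-Reasoning
        Us = filter (leafCounts? i j) Ts
        by-cases : Dec (LeafCounts i j T) → weight T i j ℚ.+ sumList Ts weight i j ≡ toℚ (length (filter (leafCounts? i j) (T ∷ Ts)))
        by-cases (yes counts) = begin
          weight T i j ℚ.+ sumList Ts weight i j  ≡⟨ ≡.cong₂ ℚ._+_ (weight-at T counts) (sumList-weight Ts) ⟩
          1ℚ ℚ.+ toℚ (length Us)                   ≡⟨ toℚ-suc (length Us) ⟨
          toℚ (length (T ∷ Us))                    ≡⟨ ≡.cong (λ Vs → toℚ (length Vs)) (filter-accept (leafCounts? i j) {T} {Ts} counts) ⟨
          toℚ (length (filter (leafCounts? i j) (T ∷ Ts))) ∎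
        by-cases (no ¬counts) = begin
          weight T i j ℚ.+ sumList Ts weight i j  ≡⟨ ≡.cong₂ ℚ._+_ (weight-elsewhere T ¬counts) (sumList-weight Ts) ⟩
          0ℚ ℚ.+ toℚ (length Us)                   ≡⟨ ℚ.+-identityˡ (toℚ (length Us)) ⟩
          toℚ (length Us)                          ≡⟨ ≡.cong (λ Vs → toℚ (length Vs)) (filter-reject (leafCounts? i j) {T} {Ts} ¬counts) ⟨
          toℚ (length (filter (leafCounts? i j) (T ∷ Ts))) ∎

    G-coefficient : ∀ n → G n i j ≡ toℚ (length (treesWith i j n))
    G-coefficient n = ≡.trans (≡.cong-app (≡.cong-app (≡.sym (sumList-map node (forests (suc n) n) weight)) i) j)
                              (sumList-weight (treesWithEdges n))
open import Data.Nat as ℕ using (ℕ; suc)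
open import Data.Integer using (+_)
open import Data.Rational as ℚ using (_/_; ½)
open import Data.Product using (Σ; _×_; _,_)
open import Data.Fin using (Fin)
open import Data.List using (length)
open import Function.Bundles using (_↔_)
open import Relation.Binary.PropositionalEquality as ≡ using (_≡_)
import Algebra.Properties.Ring as RingProperties

open import Defs
open Trivariate
open GeneratingFunction
open PlaneTrees using (treesWith; treesWith↔)
open BinomialHalf using (half-sum; toℚ)
open _-Raw-AlmostCommutative⟶_ scalar using (⟦_⟧)
open QuadraticRelation ℚ⟦s,t,z⟧ scalar
open import Algebra.Definitions.RawSemiring (Semiring.rawSemiring 𝕊.semiring) using (_∣_)

t s : Sᶻ.Series
t = monomial³ 1 0 0
s = monomial³ 0 1 0

discRoot-G-square : discRoot t s z G 𝕊.* discRoot t s z G 𝕊.≈ discriminant t s z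
discRoot-G-square = discRoot-square {t} {s} {z} {G} {Y}
  (𝕊.trans G-equation (𝕊.+-congˡ {𝕊.1#} (𝕊.*-congˡ {z} (𝕊.*-congʳ {Y} τ-equation))))
  (𝕊.trans Y-equation (𝕊.+-congˡ {𝕊.1#} (𝕊.*-congˡ {z} (𝕊.*-congʳ {Y} σ-equation))))

private
  factor : ∀ a b c a′ b′ c′ → monomial³ (a ℕ.+ a′) (b ℕ.+ b′) (c ℕ.+ c′) 𝕊.≈ monomial³ a b c 𝕊.* monomial³ a′ b′ c′
  factor a b c a′ b′ c′ = 𝕊.sym (monomial³-* a b c a′ b′ c′)

  z² : monomial³ 0 0 2 𝕊.≈ z 𝕊.* z
  z² = factor 0 0 1 0 0 1

embed-Disc : embed Disc 𝕊.≈ discriminant t s z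
embed-Disc =
  𝕊.+-cong
    (𝕊.+-cong (embed-mono 0 0 0)
      (𝕊.-‿cong (𝕊.trans (embed-scale (+ 2 / 1) (mono 0 0 1 ⊕ mono 0 1 1))
        (𝕊.*-congˡ {⟦ + 2 / 1 ⟧} (𝕊.+-cong (embed-mono 0 0 1) (𝕊.trans (embed-mono 0 1 1) (factor 0 1 0 0 0 1)))))))
    (𝕊.+-cong
      (𝕊.+-cong
        (𝕊.+-cong (𝕊.trans (embed-mono 0 0 2) z²)
          (𝕊.-‿cong (𝕊.trans (embed-scale (+ 4 / 1) (mono 1 0 2))
            (𝕊.*-congˡ {⟦ + 4 / 1 ⟧} (𝕊.trans (embed-mono 1 0 2) (𝕊.trans (factor 1 0 0 0 0 2) (𝕊.*-congˡ {t} z²)))))))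
        (𝕊.trans (embed-scale (+ 2 / 1) (mono 0 1 2))
          (𝕊.*-congˡ {⟦ + 2 / 1 ⟧} (𝕊.trans (embed-mono 0 1 2) (𝕊.trans (factor 0 1 0 0 0 2) (𝕊.*-congˡ {s} z²))))))
      (𝕊.trans (embed-mono 0 2 2) (𝕊.trans (factor 0 2 0 0 0 2) (𝕊.*-cong (factor 0 1 0 0 1 0) z²))))

constant-term-of-multiple : ∀ {F} → z ∣ F → F 0 𝔸.≈ 𝔸.0#
constant-term-of-multiple {F} record { quotient = q ; equality = qz≈F } =
  𝔸.trans (𝔸.sym (qz≈F 0)) (𝔸.trans (Sᶻ.*ₛ-comm q z 0) (Sᶻ.X*ₛ-zero q))

u : Sᶻ.Series
u = embed (Disc ⊖ one)

u₀≈0 : u 0 𝔸.≈ 𝔸.0#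
u₀≈0 = 𝔸.trans (𝕊.+-cong embed-Disc (𝕊.-‿cong (embed-mono 0 0 0)) 0) (constant-term-of-multiple (z∣discriminant-1 t s z))

√D : Sᶻ.Series
√D = binHalfᵗ Sᶻ.∘ₛ u

√D-square : √D 𝕊.* √D 𝕊.≈ discriminant t s z
√D-square = begin
  √D 𝕊.* √D                            ≈⟨ Sᶻ.Composition.compose-square u₀≈0 binHalfᵗ binHalfᵗ-square ⟩
  𝕊.1# 𝕊.+ (embed Disc 𝕊.- embed one)  ≈⟨ 𝕊.+-congˡ {𝕊.1#} (𝕊.+-congˡ {embed Disc} (𝕊.-‿cong (embed-mono 0 0 0))) ⟩
  𝕊.1# 𝕊.+ (embed Disc 𝕊.- 𝕊.1#)       ≈⟨ 𝕊.+-comm 𝕊.1# _ ⟩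
  (embed Disc 𝕊.- 𝕊.1#) 𝕊.+ 𝕊.1#       ≈⟨ 𝕊.+-assoc (embed Disc) _ _ ⟩
  embed Disc 𝕊.+ (𝕊.- 𝕊.1# 𝕊.+ 𝕊.1#)   ≈⟨ 𝕊.+-congˡ {embed Disc} (𝕊.-‿inverseˡ 𝕊.1#) ⟩
  embed Disc 𝕊.+ 𝕊.0#                  ≈⟨ 𝕊.+-identityʳ (embed Disc) ⟩
  embed Disc                           ≈⟨ embed-Disc ⟩
  discriminant t s z                   ∎
  where open import Relation.Binary.Reasoning.Setoid 𝕊.setoid

rootG : Sᶻ.Series
rootG = discRoot t s z G

private
  -- Both square roots have constant term 1, so their sum has the invertible constant term 2.
  √D+rootG-regular : ∀ x → x 𝔸.* (√D 0 𝔸.+ rootG 0) 𝔸.≈ 𝔸.0# → x 𝔸.≈ 𝔸.0#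
  √D+rootG-regular x x[√D₀+rootG₀]≈0 i j = ≡.trans (≡.sym (half-sum (x i j))) (≡.cong (½ ℚ.*_) (x+x≈0 i j))
    where
    rootG₀≈1 : rootG 0 𝔸.≈ 𝔸.1#
    rootG₀≈1 = RingProperties.x∙y⁻¹≈ε⇒x≈y 𝔸.ring (rootG 0) 𝔸.1# (constant-term-of-multiple (z∣discRoot-1 t s z G))
    x+x≈0 : x 𝔸.+ x 𝔸.≈ 𝔸.0#
    x+x≈0 = begin
      x 𝔸.+ x                      ≈⟨ 𝔸.+-cong (𝔸.*-identityʳ x) (𝔸.*-identityʳ x) ⟨
      x 𝔸.* 𝔸.1# 𝔸.+ x 𝔸.* 𝔸.1#    ≈⟨ 𝔸.distribˡ x 𝔸.1# 𝔸.1# ⟨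
      x 𝔸.* (𝔸.1# 𝔸.+ 𝔸.1#)        ≈⟨ 𝔸.*-congˡ {x} (𝔸.+-cong (𝔸.*-identityˡ 𝔸.1#) rootG₀≈1) ⟨
      x 𝔸.* (√D 0 𝔸.+ rootG 0)     ≈⟨ x[√D₀+rootG₀]≈0 ⟩
      𝔸.0#                         ∎
      where open import Relation.Binary.Reasoning.Setoid 𝔸.setoid

√D≈rootG : √D 𝕊.≈ rootG
√D≈rootG = RingProperties.x∙y⁻¹≈ε⇒x≈y 𝕊.ring √D rootG
  (Sᶻ.*ₛ-cancel-regularʳ {√D 𝕊.- rootG} {√D 𝕊.+ rootG} √D+rootG-regular
    (difference-of-squares-≈0 {√D} {rootG} √D-square discRoot-G-square))

embed-Numer : embed Numer 𝕊.≈ z 𝕊.* (G 𝕊.+ G)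
embed-Numer = 𝕊.trans
  (𝕊.+-cong (𝕊.+-cong (𝕊.+-cong (embed-mono 0 0 0) (embed-mono 0 0 1)) (𝕊.-‿cong (𝕊.trans (embed-mono 0 1 1) (factor 0 1 0 0 0 1))))
            (𝕊.-‿cong (𝕊.trans (embed-sqrt1 Disc) √D≈rootG)))
  (numerator-discRoot t s z G)

RHS-coefficient : ∀ i j n → RHS i j n ≡ toℚ (length (treesWith i j n))
RHS-coefficient i j n = begin
  ½ ℚ.* embed Numer (suc n) i j             ≡⟨ ≡.cong (½ ℚ.*_) (embed-Numer (suc n) i j) ⟩
  ½ ℚ.* (z 𝕊.* (G 𝕊.+ G)) (suc n) i j      ≡⟨ ≡.cong (½ ℚ.*_) (Sᶻ.X*ₛ-suc (G 𝕊.+ G) n i j) ⟩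
  ½ ℚ.* (G n i j ℚ.+ G n i j)               ≡⟨ half-sum (G n i j) ⟩
  G n i j                                   ≡⟨ G-coefficient i j n ⟩
  toℚ (length (treesWith i j n))            ∎
  where open ≡.≡-Reasoning

mainTheorem1 : (i j n : ℕ) →
    Σ ℕ (λ k → (Fin k ↔ TreesWith i j n) × (RHS i j n ≡ (+ k) / 1))
mainTheorem1 i j n = length (treesWith i j n) , treesWith↔ i j n , RHS-coefficient i j n
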